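{- For every integer $d\ge0$ and every $k$, the coefficient of $x^k$ in $g(L_d,x)$ equals the number of plane trees on $d+1$ vertices with exactly $k$ type $(0)$ special vertices.
   Context: Stanley's toric polynomials: for a finite poset $P$ with minimum $\hat0$ such that $P\cup\{\hat1\}$ is Eulerian of rank $d+1$ with rank function $\rho$, define recursively $f(\emptyset,x)=g(\emptyset,x)=1$; for $d+1\ge1$, $f(P,x)=\sum_{t\in P}g([\hat0,t),x)(x-1)^{d-\rho(t)}$, and writing $f(P,x)=\sum k_ix^i$, $g(P,x)=\sum_{i=0}^{\lfloor d/2\rfloor}(k_i-k_{i-1})x^i$ with $k_{ -1}=0$. $L_d$ denotes the face lattice of the $d$-dimensional cube (including the empty face) with its maximum element (the cube itself) removed. A plane tree is a rooted tree whose children at each vertex are linearly ordered left to right; a vertex $v$ is a type $(0)$ special vertex if $v$ is a leaf, $v$ is the leftmost child of its parent, and the parent of $v$ is not the root. -}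

module Defs where

open import Data.Nat using (ℕ; zero; suc; _∸_; ⌊_/2⌋)
open import Data.Integer using (ℤ; +_; _-_) renaming (_+_ to _+ℤ_; _*_ to _*ℤ_; -_ to -ℤ_)
open import Data.Bool using (Bool; true; false; _∧_; _∨_; not; if_then_else_)
open import Data.List using (List; []; _∷_; map; foldr; length; filterᵇ; upTo; _++_)
open import Data.Vec using (Vec; []; _∷_)
open import Data.Maybe using (Maybe; nothing; just)

-- Polynomials with integer coefficients, as little-endian coefficient lists

Poly : Set
Poly = List ℤ

_⊕_ : Poly → Poly → Poly
[] ⊕ q = q
(a ∷ p) ⊕ [] = a ∷ p
(a ∷ p) ⊕ (b ∷ q) = (a +ℤ b) ∷ (p ⊕ q)

scale : ℤ → Poly → Poly
scale c = map (c *ℤ_)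

_⊗_ : Poly → Poly → Poly
[] ⊗ q = []
(a ∷ p) ⊗ q = scale a q ⊕ (+ 0 ∷ (p ⊗ q))

xm1^ : ℕ → Poly
xm1^ zero = + 1 ∷ []
xm1^ (suc n) = (-ℤ (+ 1) ∷ + 1 ∷ []) ⊗ xm1^ n

coeff : Poly → ℕ → ℤ
coeff [] i = + 0
coeff (a ∷ p) zero = a
coeff (a ∷ p) (suc i) = coeff p i

-- Stanley's toric polynomials f, g for a finite poset P with minimum,
-- given as a list of elements of an ambient type A with a (Boolean)
-- strict order _<ᵇ_ and rank function ρ.  The parameter r is the rank
-- d+1 of P ∪ {1̂}.  The lower interval [0̂,t) is the sublist of
-- elements strictly below t, and has r = ρ(t) (rank of [0̂,t]).
-- Recursion uses fuel (length of the list suffices, since t ∉ [0̂,t)).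

module Toric {A : Set} (_<ᵇ_ : A → A → Bool) (ρ : A → ℕ) where

  gFromF : ℕ → Poly → Poly
  gFromF r f = map (λ i → diff i) (upTo (suc ⌊ (r ∸ 1) /2⌋))
    where
    diff : ℕ → ℤ
    diff zero = coeff f zero
    diff (suc i) = coeff f (suc i) - coeff f i

  mutual
    fF : ℕ → List A → ℕ → Poly
    fF _ [] r = + 1 ∷ []
    fF zero (_ ∷ _) r = + 1 ∷ []   -- never reached with sufficient fuel
    fF (suc n) S r =
      foldr _⊕_ [] (map (λ t → gF n (filterᵇ (λ s → s <ᵇ t) S) (ρ t) ⊗ xm1^ (r ∸ 1 ∸ ρ t)) S)

    gF : ℕ → List A → ℕ → Poly
    gF _ [] r = + 1 ∷ []
    gF n (x ∷ S) r = gFromF r (fF n (x ∷ S) r)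

  fPoly : List A → ℕ → Poly
  fPoly S r = fF (length S) S r

  gPoly : List A → ℕ → Poly
  gPoly S r = gF (length S) S r

-- Face lattice of the d-cube: the empty face (nothing), or a nonempty
-- face encoded by a vector over {0,1,*}.

data F3 : Set where
  z o ⋆ : F3

Face : ℕ → Set
Face d = Maybe (Vec F3 d)

_==₃_ : F3 → F3 → Bool
z ==₃ z = true
o ==₃ o = true
⋆ ==₃ ⋆ = true
_ ==₃ _ = false

leV : ∀ {d} → Vec F3 d → Vec F3 d → Bool
leV [] [] = true
leV (a ∷ u) (b ∷ v) = ((a ==₃ b) ∨ (b ==₃ ⋆)) ∧ leV u v

eqV : ∀ {d} → Vec F3 d → Vec F3 d → Bool
eqV [] [] = true
eqV (a ∷ u) (b ∷ v) = (a ==₃ b) ∧ eqV u v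

_<F_ : ∀ {d} → Face d → Face d → Bool
nothing <F nothing = false
nothing <F just _ = true
just _ <F nothing = false
just u <F just v = leV u v ∧ not (eqV u v)

stars : ∀ {d} → Vec F3 d → ℕ
stars [] = zero
stars (⋆ ∷ v) = suc (stars v)
stars (_ ∷ v) = stars v

rankF : ∀ {d} → Face d → ℕ
rankF nothing = zero
rankF (just v) = suc (stars v)

allVec : (d : ℕ) → List (Vec F3 d)
allVec zero = [] ∷ []
allVec (suc d) = foldr (λ v acc → (z ∷ v) ∷ (o ∷ v) ∷ (⋆ ∷ v) ∷ acc) [] (allVec d)

allStar : (d : ℕ) → Vec F3 d
allStar zero = []
allStar (suc d) = ⋆ ∷ allStar d

L : (d : ℕ) → List (Face d)
L d = nothing ∷ map just (filterᵇ (λ v → not (eqV v (allStar d))) (allVec d))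

-- g(L_d, x); here P ∪ {1̂} has rank d+1
gL : ℕ → Poly
gL d = Toric.gPoly (_<F_ {d}) rankF (L d) (suc d)

data PlaneTree : Set where
  node : List PlaneTree → PlaneTree

mutual
  size : PlaneTree → ℕ
  size (node cs) = suc (sizes cs)

  sizes : List PlaneTree → ℕ
  sizes [] = zero
  sizes (c ∷ cs) = size c Data.Nat.+ sizes cs

isLeaf : PlaneTree → Bool
isLeaf (node []) = true
isLeaf (node (_ ∷ _)) = false

mutual
  -- number of type (0) special vertices in the subtree of a NON-ROOT vertex
  -- (counting those whose parent lies in this subtree)
  specNR : PlaneTree → ℕ
  specNR (node []) = zero
  specNR (node (c ∷ cs)) =
    (if isLeaf c then 1 else 0) Data.Nat.+ specNRs (c ∷ cs)

  specNRs : List PlaneTree → ℕ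
  specNRs [] = zero
  specNRs (c ∷ cs) = specNR c Data.Nat.+ specNRs cs

-- number of type (0) special vertices: leaves that are leftmost children
-- of a non-root parent
special : PlaneTree → ℕ
special (node cs) = specNRs cs

module Submission where

-- Write y = x - 1, and for s ≥ 0 let T_s(x) = Σ x^{special} over plane
-- forests with s vertices (a forest with s vertices is the list of root
-- subtrees of a plane tree with s+1 vertices).  A face v of the cube with s
-- stars has C(s,j)·2^{s-j} faces with j stars below it, so by induction on
-- faces, if g([0̂,u)) = T_{stars u} for all faces u < v, then
--   y · f([0̂,v)) = (X T)_s - T_s + y^{s+1},
-- where X is the Pascal transform (X F)_s = Σ_j C(s,j) (2y)^{s-j} F_j.
-- A generating-function identity gives (X T)_s = R_s - y^{s+1}, where R_s
-- has no terms of degree ≤ ⌊s/2⌋ while T_s has none of degree > ⌊s/2⌋;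
-- hence the truncated differences defining g([0̂,v)) are exactly T_s.
--
-- The identity lives in ℤ[[x]][[z]]: t = Σ T_s z^s and r = Σ R_s z^s satisfy
-- the quadratic equations t = 1 + z(1+yz)t² and r = (1+y) + z(1-yz)r²
-- (first-child decompositions of forests), X is multiplicative up to the
-- unit (1 - 2yz), and a quadratic recursion of this shape has a unique
-- solution, which forces X t = r - y/(1-yz).

open import Algebra using (CommutativeRing)
open import Level using (0ℓ)
open import Data.Nat using (ℕ; suc; _≤_; _<_; ⌊_/2⌋)
open import Data.Integer using (+_)
open import Relation.Binary.PropositionalEquality using (_≡_)

module IntegerSolver (R : CommutativeRing 0ℓ 0ℓ) where

  open import Data.Nat as ℕ using (ℕ; zero; suc)
  import Data.Nat.Properties as ℕP
  open import Data.Integer as ℤ using (ℤ; +_; -[1+_]; _⊖_; _◃_)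
  import Data.Integer.Properties as ℤP
  import Data.Sign as Sign
  open import Data.Maybe using (Maybe; just; nothing)
  open import Relation.Nullary using (yes; no)
  import Relation.Binary.PropositionalEquality as P
  open CommutativeRing R
  open import Relation.Binary.Reasoning.Setoid setoid
  open import Algebra.Properties.Semiring.Mult.TCOptimised semiring
  open import Algebra.Properties.Ring ring using (-‿distribˡ-*; -‿distribʳ-*)
  open import Algebra.Properties.AbelianGroup +-abelianGroup using (⁻¹-∙-comm)
  open import Algebra.Properties.Group +-group using (ε⁻¹≈ε; ⁻¹-involutive)
  import Algebra.Solver.Ring.AlmostCommutativeRing as ACR
  open ACR using (_-Raw-AlmostCommutative⟶_)

  ⟦_⟧ℤ : ℤ → Carrier
  ⟦ + n ⟧ℤ = n × 1#
  ⟦ -[1+ n ] ⟧ℤ = - (suc n × 1#)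

  private
    suc× : ∀ n → suc n × 1# ≈ 1# + n × 1#
    suc× n = ×-homo-+ 1# 1 n

    swap-middle : ∀ a b c d → (a + b) + (c + d) ≈ (a + c) + (b + d)
    swap-middle a b c d = begin
      (a + b) + (c + d) ≈⟨ +-assoc a b (c + d) ⟩
      a + (b + (c + d)) ≈⟨ +-congˡ (sym (+-assoc b c d)) ⟩
      a + ((b + c) + d) ≈⟨ +-congˡ (+-congʳ (+-comm b c)) ⟩
      a + ((c + b) + d) ≈⟨ +-congˡ (+-assoc c b d) ⟩
      a + (c + (b + d)) ≈⟨ sym (+-assoc a c (b + d)) ⟩
      (a + c) + (b + d) ∎

    neg-+ : ∀ a b → - (a + b) ≈ - a + - b
    neg-+ a b = sym (⁻¹-∙-comm a b)

    cancel-1# : ∀ a b → (1# + a) + - (1# + b) ≈ a + - b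
    cancel-1# a b = begin
      (1# + a) + - (1# + b) ≈⟨ +-congˡ (neg-+ 1# b) ⟩
      (1# + a) + (- 1# + - b) ≈⟨ swap-middle 1# a (- 1#) (- b) ⟩
      (1# + - 1#) + (a + - b) ≈⟨ +-congʳ (-‿inverseʳ 1#) ⟩
      0# + (a + - b) ≈⟨ +-identityˡ _ ⟩
      a + - b ∎

    ⊖-homo : ∀ m n → ⟦ m ⊖ n ⟧ℤ ≈ m × 1# + - (n × 1#)
    ⊖-homo m zero = begin
      ⟦ m ⊖ 0 ⟧ℤ ≈⟨ reflexive (P.cong ⟦_⟧ℤ (ℤP.⊖-≥ {m} {0} ℕ.z≤n)) ⟩
      ⟦ + (m ℕ.∸ 0) ⟧ℤ ≈⟨ sym (+-identityʳ _) ⟩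
      m × 1# + 0# ≈⟨ +-congˡ (sym ε⁻¹≈ε) ⟩
      m × 1# + - 0# ∎
    ⊖-homo zero (suc n) = sym (+-identityˡ _)
    ⊖-homo (suc m) (suc n) = begin
      ⟦ suc m ⊖ suc n ⟧ℤ ≈⟨ reflexive (P.cong ⟦_⟧ℤ (ℤP.[1+m]⊖[1+n]≡m⊖n m n)) ⟩
      ⟦ m ⊖ n ⟧ℤ ≈⟨ ⊖-homo m n ⟩
      m × 1# + - (n × 1#) ≈⟨ sym (cancel-1# _ _) ⟩
      (1# + m × 1#) + - (1# + n × 1#) ≈⟨ sym (+-cong (suc× m) (-‿cong (suc× n))) ⟩
      suc m × 1# + - (suc n × 1#) ∎

    +-homo : ∀ i j → ⟦ i ℤ.+ j ⟧ℤ ≈ ⟦ i ⟧ℤ + ⟦ j ⟧ℤ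
    +-homo -[1+ m ] -[1+ n ] = begin
      - (suc (suc (m ℕ.+ n)) × 1#) ≈⟨ -‿cong (reflexive (P.cong (_× 1#) (P.sym (ℕP.+-suc (suc m) n)))) ⟩
      - ((suc m ℕ.+ suc n) × 1#) ≈⟨ -‿cong (×-homo-+ 1# (suc m) (suc n)) ⟩
      - (suc m × 1# + suc n × 1#) ≈⟨ neg-+ _ _ ⟩
      - (suc m × 1#) + - (suc n × 1#) ∎
    +-homo -[1+ m ] (+ n) = trans (⊖-homo n (suc m)) (+-comm _ _)
    +-homo (+ m) -[1+ n ] = ⊖-homo m (suc n)
    +-homo (+ m) (+ n) = ×-homo-+ 1# m n

    neg-homo : ∀ i → ⟦ ℤ.- i ⟧ℤ ≈ - ⟦ i ⟧ℤ
    neg-homo (+ zero) = sym ε⁻¹≈ε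
    neg-homo (+ suc n) = refl
    neg-homo -[1+ n ] = sym (⁻¹-involutive _)

    ◃-homo⁺ : ∀ n → ⟦ Sign.+ ◃ n ⟧ℤ ≈ n × 1#
    ◃-homo⁺ zero = refl
    ◃-homo⁺ (suc n) = refl

    ◃-homo⁻ : ∀ n → ⟦ Sign.- ◃ n ⟧ℤ ≈ - (n × 1#)
    ◃-homo⁻ zero = sym ε⁻¹≈ε
    ◃-homo⁻ (suc n) = refl

    neg-*-neg : ∀ a b → - a * - b ≈ a * b
    neg-*-neg a b = begin
      - a * - b ≈⟨ sym (-‿distribˡ-* a (- b)) ⟩
      - (a * - b) ≈⟨ -‿cong (sym (-‿distribʳ-* a b)) ⟩
      - - (a * b) ≈⟨ ⁻¹-involutive _ ⟩
      a * b ∎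

    *-homo : ∀ i j → ⟦ i ℤ.* j ⟧ℤ ≈ ⟦ i ⟧ℤ * ⟦ j ⟧ℤ
    *-homo (+ m) (+ n) = trans (◃-homo⁺ (m ℕ.* n)) (×1-homo-* m n)
    *-homo (+ zero) -[1+ n ] = trans (◃-homo⁺ 0) (sym (zeroˡ _))
    *-homo (+ suc m) -[1+ n ] = begin
      ⟦ Sign.- ◃ (suc m ℕ.* suc n) ⟧ℤ ≈⟨ ◃-homo⁻ (suc m ℕ.* suc n) ⟩
      - ((suc m ℕ.* suc n) × 1#) ≈⟨ -‿cong (×1-homo-* (suc m) (suc n)) ⟩
      - (suc m × 1# * (suc n × 1#)) ≈⟨ -‿distribʳ-* _ _ ⟩
      suc m × 1# * - (suc n × 1#) ∎
    *-homo -[1+ m ] (+ zero) = begin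
      ⟦ Sign.- ◃ (suc m ℕ.* 0) ⟧ℤ ≈⟨ reflexive (P.cong (λ k → ⟦ Sign.- ◃ k ⟧ℤ) (ℕP.*-zeroʳ (suc m))) ⟩
      0# ≈⟨ sym (zeroʳ _) ⟩
      - (suc m × 1#) * 0# ∎
    *-homo -[1+ m ] (+ suc n) = begin
      ⟦ Sign.- ◃ (suc m ℕ.* suc n) ⟧ℤ ≈⟨ ◃-homo⁻ (suc m ℕ.* suc n) ⟩
      - ((suc m ℕ.* suc n) × 1#) ≈⟨ -‿cong (×1-homo-* (suc m) (suc n)) ⟩
      - (suc m × 1# * (suc n × 1#)) ≈⟨ -‿distribˡ-* _ _ ⟩
      - (suc m × 1#) * (suc n × 1#) ∎
    *-homo -[1+ m ] -[1+ n ] = begin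
      ⟦ Sign.+ ◃ (suc m ℕ.* suc n) ⟧ℤ ≈⟨ ◃-homo⁺ (suc m ℕ.* suc n) ⟩
      (suc m ℕ.* suc n) × 1# ≈⟨ ×1-homo-* (suc m) (suc n) ⟩
      suc m × 1# * (suc n × 1#) ≈⟨ sym (neg-*-neg _ _) ⟩
      - (suc m × 1#) * - (suc n × 1#) ∎

  ℤ⟶R : ℤ.+-*-rawRing -Raw-AlmostCommutative⟶ ACR.fromCommutativeRing R
  ℤ⟶R = record
    { ⟦_⟧ = ⟦_⟧ℤ ; +-homo = +-homo ; *-homo = *-homo ; -‿homo = neg-homo
    ; 0-homo = refl ; 1-homo = refl }

  ℤ-equal? : ∀ i j → Maybe (⟦ i ⟧ℤ ≈ ⟦ j ⟧ℤ)
  ℤ-equal? i j with i ℤ.≟ j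
  ... | yes P.refl = just refl
  ... | no _ = nothing

  open import Algebra.Solver.Ring ℤ.+-*-rawRing (ACR.fromCommutativeRing R) ℤ⟶R ℤ-equal? public

-- Congruences with the fixed operand explicit, which keeps Agda from having
-- to infer it in long equational chains.
module ExplicitCongruence (R : CommutativeRing 0ℓ 0ℓ) where
  open CommutativeRing R

  +ˡ : ∀ a {b c} → b ≈ c → a + b ≈ a + c
  +ˡ a p = +-congˡ p
  +ʳ : ∀ c {a b} → a ≈ b → a + c ≈ b + c
  +ʳ c p = +-congʳ p
  *ˡ : ∀ a {b c} → b ≈ c → a * b ≈ a * c
  *ˡ a p = *-congˡ p
  *ʳ : ∀ c {a b} → a ≈ b → a * c ≈ b * c
  *ʳ c p = *-congʳ p

-- Reasoning modulo hypotheses: a polynomial identity L = Rh + Σ cᵢ(uᵢ - vᵢ),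
-- checked by the solver, yields L ≈ Rh as soon as each uᵢ ≈ vᵢ.
module ModuloHypotheses (R : CommutativeRing 0ℓ 0ℓ) where
  open CommutativeRing R

  modulo₁ : ∀ {L Rh u v} c → L ≈ Rh + c * (u - v) → u ≈ v → L ≈ Rh
  modulo₁ {u = u} {v} c e u≈v = trans e (trans (+-congˡ c*0) (+-identityʳ _))
    where
    c*0 : c * (u - v) ≈ 0#
    c*0 = trans (*-congˡ (trans (+-congʳ u≈v) (-‿inverseʳ v))) (zeroʳ c)

  modulo₂ : ∀ {L Rh u₁ v₁ u₂ v₂} c₁ c₂ → L ≈ Rh + c₁ * (u₁ - v₁) + c₂ * (u₂ - v₂) →
            u₁ ≈ v₁ → u₂ ≈ v₂ → L ≈ Rh
  modulo₂ c₁ c₂ e p₁ p₂ = modulo₁ c₁ (modulo₁ c₂ e p₂) p₁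

  modulo₃ : ∀ {L Rh u₁ v₁ u₂ v₂ u₃ v₃} c₁ c₂ c₃ →
            L ≈ Rh + c₁ * (u₁ - v₁) + c₂ * (u₂ - v₂) + c₃ * (u₃ - v₃) →
            u₁ ≈ v₁ → u₂ ≈ v₂ → u₃ ≈ v₃ → L ≈ Rh
  modulo₃ c₁ c₂ c₃ e p₁ p₂ p₃ = modulo₁ c₁ (modulo₂ c₂ c₃ e p₂ p₃) p₁

  modulo₅ : ∀ {L Rh u₁ v₁ u₂ v₂ u₃ v₃ u₄ v₄ u₅ v₅} c₁ c₂ c₃ c₄ c₅ →
            L ≈ Rh + c₁ * (u₁ - v₁) + c₂ * (u₂ - v₂) + c₃ * (u₃ - v₃) + c₄ * (u₄ - v₄) + c₅ * (u₅ - v₅) →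
            u₁ ≈ v₁ → u₂ ≈ v₂ → u₃ ≈ v₃ → u₄ ≈ v₄ → u₅ ≈ v₅ → L ≈ Rh
  modulo₅ c₁ c₂ c₃ c₄ c₅ e p₁ p₂ p₃ p₄ p₅ = modulo₂ c₁ c₂ (modulo₃ c₃ c₄ c₅ e p₃ p₄ p₅) p₁ p₂

module PowerSeries (R : CommutativeRing 0ℓ 0ℓ) where

  open import Data.Nat using (ℕ; zero; suc; _≤_; z≤n; s≤s)
  import Data.Nat.Properties as ℕP
  open import Data.Product using (_,_)
  open import Algebra.Structures using (IsCommutativeRing)
  open import Relation.Binary.Structures using (IsEquivalence)
  open CommutativeRing R
  open import Relation.Binary.Reasoning.Setoid setoid
  open IntegerSolver R using (solve; _:=_; _:+_; _:*_)

  Ser : Set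
  Ser = ℕ → Carrier

  -- coefficientwise equality, and its packaging as a record so that
  -- equations between series are not unfolded by the type checker
  infix 4 _≋_ _≐_
  _≐_ : Ser → Ser → Set
  f ≐ g = ∀ n → f n ≈ g n

  record _≋_ (f g : Ser) : Set where
    constructor ⟨_⟩
    field at : f ≐ g
  open _≋_ public

  infixl 6 _+ₛ_
  infixl 7 _*ₛ_

  _+ₛ_ : Ser → Ser → Ser
  (f +ₛ g) n = f n + g n

  -ₛ_ : Ser → Ser
  (-ₛ f) n = - f n

  0ₛ : Ser
  0ₛ n = 0#

  1ₛ : Ser
  1ₛ zero = 1#
  1ₛ (suc n) = 0#

  _·ₛ_ : Carrier → Ser → Ser
  (c ·ₛ f) n = c * f n

  -- the series (f - f₀)/z
  sh : Ser → Ser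
  sh f n = f (suc n)

  _*ₛ_ : Ser → Ser → Ser
  (f *ₛ g) zero = f 0 * g 0
  (f *ₛ g) (suc n) = f 0 * g (suc n) + (sh f *ₛ g) n

  *ₛ-cong : ∀ {f f' g g'} → f ≐ f' → g ≐ g' → f *ₛ g ≐ f' *ₛ g'
  *ₛ-cong p q zero = *-cong (p 0) (q 0)
  *ₛ-cong p q (suc n) = +-cong (*-cong (p 0) (q (suc n))) (*ₛ-cong (λ m → p (suc m)) q n)

  *ₛ-zeroˡ : ∀ g → 0ₛ *ₛ g ≐ 0ₛ
  *ₛ-zeroˡ g zero = zeroˡ (g 0)
  *ₛ-zeroˡ g (suc n) = trans (+-cong (zeroˡ _) (*ₛ-zeroˡ g n)) (+-identityˡ 0#)

  *ₛ-distribʳ : ∀ f g h → (f +ₛ g) *ₛ h ≐ f *ₛ h +ₛ g *ₛ h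
  *ₛ-distribʳ f g h zero = distribʳ (h 0) (f 0) (g 0)
  *ₛ-distribʳ f g h (suc n) = begin
    (f 0 + g 0) * h (suc n) + ((sh f +ₛ sh g) *ₛ h) n
      ≈⟨ +-congˡ (*ₛ-distribʳ (sh f) (sh g) h n) ⟩
    (f 0 + g 0) * h (suc n) + ((sh f *ₛ h) n + (sh g *ₛ h) n)
      ≈⟨ solve 5 (λ a b c d e → ((a :+ b) :* c :+ (d :+ e)) := ((a :* c :+ d) :+ (b :* c :+ e))) refl (f 0) (g 0) (h (suc n)) ((sh f *ₛ h) n) ((sh g *ₛ h) n) ⟩
    (f 0 * h (suc n) + (sh f *ₛ h) n) + (g 0 * h (suc n) + (sh g *ₛ h) n) ∎

  *ₛ-distribˡ : ∀ f g h → f *ₛ (g +ₛ h) ≐ f *ₛ g +ₛ f *ₛ h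
  *ₛ-distribˡ f g h zero = distribˡ (f 0) (g 0) (h 0)
  *ₛ-distribˡ f g h (suc n) = begin
    f 0 * (g (suc n) + h (suc n)) + (sh f *ₛ (g +ₛ h)) n
      ≈⟨ +-congˡ (*ₛ-distribˡ (sh f) g h n) ⟩
    f 0 * (g (suc n) + h (suc n)) + ((sh f *ₛ g) n + (sh f *ₛ h) n)
      ≈⟨ solve 5 (λ a b c d e → (a :* (b :+ c) :+ (d :+ e)) := ((a :* b :+ d) :+ (a :* c :+ e))) refl (f 0) (g (suc n)) (h (suc n)) ((sh f *ₛ g) n) ((sh f *ₛ h) n) ⟩
    (f 0 * g (suc n) + (sh f *ₛ g) n) + (f 0 * h (suc n) + (sh f *ₛ h) n) ∎

  *ₛ-scaleˡ : ∀ c f g → (c ·ₛ f) *ₛ g ≐ c ·ₛ (f *ₛ g)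
  *ₛ-scaleˡ c f g zero = *-assoc c (f 0) (g 0)
  *ₛ-scaleˡ c f g (suc n) = begin
    c * f 0 * g (suc n) + ((c ·ₛ sh f) *ₛ g) n ≈⟨ +-congˡ (*ₛ-scaleˡ c (sh f) g n) ⟩
    c * f 0 * g (suc n) + c * (sh f *ₛ g) n
      ≈⟨ solve 4 (λ a b d e → (a :* b :* d :+ a :* e) := (a :* (b :* d :+ e))) refl c (f 0) (g (suc n)) ((sh f *ₛ g) n) ⟩
    c * (f 0 * g (suc n) + (sh f *ₛ g) n) ∎

  *ₛ-unfoldʳ : ∀ f g n → (f *ₛ g) (suc n) ≈ f (suc n) * g 0 + (f *ₛ sh g) n
  *ₛ-unfoldʳ f g zero = +-comm _ _
  *ₛ-unfoldʳ f g (suc n) = begin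
    f 0 * g (suc (suc n)) + (sh f *ₛ g) (suc n) ≈⟨ +-congˡ (*ₛ-unfoldʳ (sh f) g n) ⟩
    f 0 * g (suc (suc n)) + (f (suc (suc n)) * g 0 + (sh f *ₛ sh g) n)
      ≈⟨ solve 3 (λ a b c → (a :+ (b :+ c)) := (b :+ (a :+ c))) refl (f 0 * g (suc (suc n))) (f (suc (suc n)) * g 0) ((sh f *ₛ sh g) n) ⟩
    f (suc (suc n)) * g 0 + (f 0 * g (suc (suc n)) + (sh f *ₛ sh g) n) ∎

  *ₛ-comm : ∀ f g → f *ₛ g ≐ g *ₛ f
  *ₛ-comm f g zero = *-comm (f 0) (g 0)
  *ₛ-comm f g (suc n) = begin
    f 0 * g (suc n) + (sh f *ₛ g) n ≈⟨ +-cong (*-comm _ _) (*ₛ-comm (sh f) g n) ⟩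
    g (suc n) * f 0 + (g *ₛ sh f) n ≈⟨ sym (*ₛ-unfoldʳ g f n) ⟩
    (g *ₛ f) (suc n) ∎

  *ₛ-identityˡ : ∀ g → 1ₛ *ₛ g ≐ g
  *ₛ-identityˡ g zero = *-identityˡ (g 0)
  *ₛ-identityˡ g (suc n) = trans (+-cong (*-identityˡ _) (*ₛ-zeroˡ g n)) (+-identityʳ _)

  *ₛ-assoc : ∀ f g h → (f *ₛ g) *ₛ h ≐ f *ₛ (g *ₛ h)
  *ₛ-assoc f g h zero = *-assoc (f 0) (g 0) (h 0)
  *ₛ-assoc f g h (suc n) = begin
    f 0 * g 0 * h (suc n) + (sh (f *ₛ g) *ₛ h) n
      ≈⟨ +-congˡ (*ₛ-distribʳ (f 0 ·ₛ sh g) (sh f *ₛ g) h n) ⟩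
    f 0 * g 0 * h (suc n) + (((f 0 ·ₛ sh g) *ₛ h) n + ((sh f *ₛ g) *ₛ h) n)
      ≈⟨ +-congˡ (+-cong (*ₛ-scaleˡ (f 0) (sh g) h n) (*ₛ-assoc (sh f) g h n)) ⟩
    f 0 * g 0 * h (suc n) + (f 0 * (sh g *ₛ h) n + (sh f *ₛ (g *ₛ h)) n)
      ≈⟨ solve 5 (λ a b c d e → (a :* b :* c :+ (a :* d :+ e)) := (a :* (b :* c :+ d) :+ e)) refl (f 0) (g 0) (h (suc n)) ((sh g *ₛ h) n) ((sh f *ₛ (g *ₛ h)) n) ⟩
    f 0 * (g 0 * h (suc n) + (sh g *ₛ h) n) + (sh f *ₛ (g *ₛ h)) n ∎

  ≋-isEquivalence : IsEquivalence _≋_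
  ≋-isEquivalence = record
    { refl = ⟨ (λ n → refl) ⟩
    ; sym = λ p → ⟨ (λ n → sym (at p n)) ⟩
    ; trans = λ p q → ⟨ (λ n → trans (at p n) (at q n)) ⟩ }

  isCommutativeRingₛ : IsCommutativeRing _≋_ _+ₛ_ _*ₛ_ -ₛ_ 0ₛ 1ₛ
  isCommutativeRingₛ = record
    { isRing = record
      { +-isAbelianGroup = record
        { isGroup = record
          { isMonoid = record
            { isSemigroup = record
              { isMagma = record { isEquivalence = ≋-isEquivalence ; ∙-cong = λ p q → ⟨ (λ n → +-cong (at p n) (at q n)) ⟩ }
              ; assoc = λ f g h → ⟨ (λ n → +-assoc (f n) (g n) (h n)) ⟩ }
            ; identity = (λ f → ⟨ (λ n → +-identityˡ (f n)) ⟩) , (λ f → ⟨ (λ n → +-identityʳ (f n)) ⟩) }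
          ; inverse = (λ f → ⟨ (λ n → -‿inverseˡ (f n)) ⟩) , (λ f → ⟨ (λ n → -‿inverseʳ (f n)) ⟩)
          ; ⁻¹-cong = λ p → ⟨ (λ n → -‿cong (at p n)) ⟩ }
        ; comm = λ f g → ⟨ (λ n → +-comm (f n) (g n)) ⟩ }
      ; *-cong = λ p q → ⟨ *ₛ-cong (at p) (at q) ⟩
      ; *-assoc = λ f g h → ⟨ *ₛ-assoc f g h ⟩
      ; *-identity = (λ g → ⟨ *ₛ-identityˡ g ⟩) , (λ g → ⟨ (λ n → trans (*ₛ-comm g 1ₛ n) (*ₛ-identityˡ g n)) ⟩)
      ; distrib = (λ f g h → ⟨ *ₛ-distribˡ f g h ⟩) , (λ h f g → ⟨ *ₛ-distribʳ f g h ⟩) }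
    ; *-comm = λ f g → ⟨ *ₛ-comm f g ⟩ }

  seriesRing : CommutativeRing 0ℓ 0ℓ
  seriesRing = record { isCommutativeRing = isCommutativeRingₛ }

  cst : Carrier → Ser
  cst c zero = c
  cst c (suc n) = 0#

  var : Ser
  var zero = 0#
  var (suc zero) = 1#
  var (suc (suc n)) = 0#

  var-mul₀ : ∀ f → (var *ₛ f) 0 ≈ 0#
  var-mul₀ f = zeroˡ (f 0)

  var-mulₛ : ∀ f n → (var *ₛ f) (suc n) ≈ f n
  var-mulₛ f n = begin
    0# * f (suc n) + (sh var *ₛ f) n ≈⟨ +-cong (zeroˡ _) (*ₛ-cong sh-var (λ m → refl) n) ⟩
    0# + (1ₛ *ₛ f) n ≈⟨ +-identityˡ _ ⟩
    (1ₛ *ₛ f) n ≈⟨ *ₛ-identityˡ f n ⟩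
    f n ∎
    where
    sh-var : sh var ≐ 1ₛ
    sh-var zero = refl
    sh-var (suc n) = refl

  cst-mul : ∀ c f → cst c *ₛ f ≐ c ·ₛ f
  cst-mul c f zero = refl
  cst-mul c f (suc n) = begin
    c * f (suc n) + (sh (cst c) *ₛ f) n ≈⟨ +-congˡ (*ₛ-zeroˡ f n) ⟩
    c * f (suc n) + 0# ≈⟨ +-identityʳ _ ⟩
    c * f (suc n) ∎

  *ₛ-local : ∀ {f f' g g'} n → (∀ i → i ≤ n → f i ≈ f' i) → (∀ j → j ≤ n → g j ≈ g' j) →
             (f *ₛ g) n ≈ (f' *ₛ g') n
  *ₛ-local zero p q = *-cong (p 0 z≤n) (q 0 z≤n)
  *ₛ-local (suc n) p q =
    +-cong (*-cong (p 0 z≤n) (q (suc n) ℕP.≤-refl))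
           (*ₛ-local n (λ i i≤n → p (suc i) (s≤s i≤n)) (λ j j≤n → q j (ℕP.m≤n⇒m≤1+n j≤n)))

module PascalTransform (R : CommutativeRing 0ℓ 0ℓ) (y : CommutativeRing.Carrier R) where

  open import Data.Nat using (zero; suc; _≤_; s≤s)
  import Data.Nat.Properties as ℕP
  open import Data.Integer using (+_)
  import Algebra
  open PowerSeries R
  module Base = CommutativeRing R
  open import Algebra.Properties.Group Base.+-group using (ε⁻¹≈ε)
  open import Algebra.Definitions.RawSemiring (Algebra.Semiring.rawSemiring Base.semiring) using (_^_)
  open CommutativeRing seriesRing
  open ModuloHypotheses seriesRing
  open import Relation.Binary.Reasoning.Setoid setoid
  open IntegerSolver seriesRing using (⟦_⟧ℤ; solve; _:=_; _:+_; _:*_; :-_; _:-_; con; Polynomial)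

  one : ∀ {m} → Polynomial m
  one = con (+ 1)

  a : Base.Carrier
  a = y Base.+ y

  A Y : Ser
  A = cst a
  Y = cst y

  cst-cong : ∀ {b c} → b Base.≈ c → cst b ≈ cst c
  cst-cong p = ⟨ pointwise p ⟩
    where
    pointwise : ∀ {b c} → b Base.≈ c → cst b ≐ cst c
    pointwise p zero = p
    pointwise p (suc n) = Base.refl

  cst-+ : ∀ b c → cst (b Base.+ c) ≈ cst b + cst c
  cst-+ b c = ⟨ pointwise ⟩
    where
    pointwise : cst (b Base.+ c) ≐ cst b + cst c
    pointwise zero = Base.refl
    pointwise (suc n) = Base.sym (Base.+-identityʳ Base.0#)

  A≈Y+Y : A ≈ Y + Y
  A≈Y+Y = cst-+ y y

  cst-* : ∀ b c → cst (b Base.* c) ≐ cst b * cst c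
  cst-* b c n = Base.trans (scaled n) (Base.sym (cst-mul b (cst c) n))
    where
    scaled : ∀ n → cst (b Base.* c) n Base.≈ b Base.* cst c n
    scaled zero = Base.refl
    scaled (suc n) = Base.sym (Base.zeroʳ b)

  cst-1 : cst Base.1# ≈ 1#
  cst-1 = ⟨ pointwise ⟩
    where
    pointwise : cst Base.1# ≐ 1#
    pointwise zero = Base.refl
    pointwise (suc n) = Base.refl

  cst-0 : cst Base.0# ≈ 0#
  cst-0 = ⟨ pointwise ⟩
    where
    pointwise : cst Base.0# ≐ 0#
    pointwise zero = Base.refl
    pointwise (suc n) = Base.refl

  -- The Pascal transform: (X F)ₙ = Σⱼ C(n,j) aⁿ⁻ʲ Fⱼ, defined by Pascal's rule.
  X : Ser → Ser
  X F zero = F 0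
  X F (suc n) = a Base.* X F n Base.+ X (sh F) n

  X-cong : ∀ {F G} → F ≈ G → X F ≈ X G
  X-cong p = ⟨ pointwise (at p) ⟩
    where
    pointwise : ∀ {F G} → F ≐ G → X F ≐ X G
    pointwise p zero = p 0
    pointwise p (suc n) = Base.+-cong (Base.*-congˡ (pointwise p n)) (pointwise (λ m → p (suc m)) n)

  X-+ : ∀ F G → X (F + G) ≈ X F + X G
  X-+ F G = ⟨ pointwise F G ⟩
    where
    pointwise : ∀ F G → X (F + G) ≐ X F + X G
    pointwise F G zero = Base.refl
    pointwise F G (suc n) =
      Base.trans (Base.+-cong (Base.*-congˡ (pointwise F G n)) (pointwise (sh F) (sh G) n))
                 (solve-base (X F n) (X G n) (X (sh F) n) (X (sh G) n))
      where
      open IntegerSolver R using () renaming (solve to solveR; _:=_ to _:=R_; _:+_ to _:+R_; _:*_ to _:*R_)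
      solve-base : ∀ p q r s → a Base.* (p Base.+ q) Base.+ (r Base.+ s) Base.≈ (a Base.* p Base.+ r) Base.+ (a Base.* q Base.+ s)
      solve-base = solveR 5 (λ c p q r s → (c :*R (p :+R q)) :+R (r :+R s) :=R (c :*R p :+R r) :+R (c :*R q :+R s)) Base.refl a

  X-cst : ∀ c F → X (cst c * F) ≈ cst c * X F
  X-cst c F = trans (X-cong ⟨ cst-mul c F ⟩) (trans ⟨ X-scale c F ⟩ (sym ⟨ cst-mul c (X F) ⟩))
    where
    X-scale : ∀ c F → X (c ·ₛ F) ≐ c ·ₛ X F
    X-scale c F zero = Base.refl
    X-scale c F (suc n) =
      Base.trans (Base.+-cong (Base.*-congˡ (X-scale c F n)) (X-scale c (sh F) n)) (solve-base c (X F n) (X (sh F) n))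
      where
      open IntegerSolver R using () renaming (solve to solveR; _:=_ to _:=R_; _:+_ to _:+R_; _:*_ to _:*R_)
      solve-base : ∀ c p q → a Base.* (c Base.* p) Base.+ c Base.* q Base.≈ c Base.* (a Base.* p Base.+ q)
      solve-base = solveR 4 (λ e c p q → e :*R (c :*R p) :+R c :*R q :=R c :*R (e :*R p :+R q)) Base.refl a

  X-0 : X 0# ≈ 0#
  X-0 = ⟨ pointwise ⟩
    where
    pointwise : X 0# ≐ 0#
    pointwise zero = Base.refl
    pointwise (suc n) = Base.trans (Base.+-cong (Base.trans (Base.*-congˡ (pointwise n)) (Base.zeroʳ a)) (pointwise n)) (Base.+-identityʳ Base.0#)

  X-rec : ∀ F → X F ≈ cst (F 0) + var * (A * X F + X (sh F))
  X-rec F = ⟨ pointwise ⟩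
    where
    pointwise : X F ≐ cst (F 0) + var * (A * X F + X (sh F))
    pointwise zero = Base.sym (Base.trans (Base.+-congˡ (var-mul₀ (A * X F + X (sh F)))) (Base.+-identityʳ _))
    pointwise (suc n) = Base.sym (Base.trans (Base.+-identityˡ _) (Base.trans (var-mulₛ (A * X F + X (sh F)) n) (Base.+-congʳ (cst-mul a (X F) n))))

  X-shift : ∀ F → (1# - A * var) * X F ≈ cst (F 0) + var * X (sh F)
  X-shift F = modulo₁ 1#
    (solve 5 (λ xf f0 p aa z → (one :- aa :* z) :* xf := (f0 :+ z :* p) :+ one :* (xf :- (f0 :+ z :* (aa :* xf :+ p))))
       refl (X F) (cst (F 0)) (X (sh F)) A var)
    (X-rec F)

  -- X is multiplicative up to the unit (1 - A z): the defect
  -- X (F G) - (1 - A z) X F X G satisfies D = z (A D + D'), hence vanishes.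
  defect : Ser → Ser → Ser
  defect F G = X (F * G) - (1# - A * var) * (X F * X G)

  defect-rec : ∀ F G → defect F G ≈ var * (A * defect F G + defect (sh F) G)
  defect-rec F G = modulo₃ 1# (- ((1# - A * var) * X G)) (- cst (F 0))
    (solve 10 (λ W Yv xf xg p q f0 g0 aa z →
       (W :- (one :- aa :* z) :* (xf :* xg))
         := (z :* (aa :* (W :- (one :- aa :* z) :* (xf :* xg)) :+ (Yv :- (one :- aa :* z) :* (p :* xg))))
            :+ one :* (W :- (f0 :* g0 :+ z :* (aa :* W :+ (f0 :* q :+ Yv))))
            :+ (:- ((one :- aa :* z) :* xg)) :* (xf :- (f0 :+ z :* (aa :* xf :+ p)))
            :+ (:- f0) :* (xg :- (g0 :+ z :* (aa :* xg :+ q))))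
       refl (X (F * G)) (X (sh F * G)) (X F) (X G) (X (sh F)) (X (sh G)) (cst (F 0)) (cst (G 0)) A var)
    product-rec (X-rec F) (X-rec G)
    where
    sh-product : sh (F * G) ≈ cst (F 0) * sh G + sh F * G
    sh-product = ⟨ (λ m → Base.+-congʳ (Base.sym (cst-mul (F 0) (sh G) m))) ⟩
    product-rec : X (F * G) ≈ cst (F 0) * cst (G 0) + var * (A * X (F * G) + (cst (F 0) * X (sh G) + X (sh F * G)))
    product-rec = trans (X-rec (F * G))
      (+-cong ⟨ cst-* (F 0) (G 0) ⟩ (*-congˡ (+-congˡ (trans (X-cong sh-product) (trans (X-+ _ _) (+-congʳ (X-cst (F 0) (sh G))))))))

  defect≈0 : ∀ n F G → defect F G n Base.≈ Base.0#
  defect≈0 zero F G = Base.trans (at (defect-rec F G) 0) (var-mul₀ (A * defect F G + defect (sh F) G))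
  defect≈0 (suc n) F G =
    -- coefficient n+1 of z (A D + D') is a Dₙ + D'ₙ, zero by induction
    Base.trans (at (defect-rec F G) (suc n)) (Base.trans (var-mulₛ (A * defect F G + defect (sh F) G) n)
      (Base.trans (Base.+-cong (Base.trans (cst-mul a (defect F G) n) (Base.trans (Base.*-congˡ (defect≈0 n F G)) (Base.zeroʳ a)))
                               (defect≈0 n (sh F) G))
                  (Base.+-identityʳ Base.0#)))

  X-multiplicative : ∀ F G → X (F * G) ≈ (1# - A * var) * (X F * X G)
  X-multiplicative F G = modulo₁ 1#
    (solve 2 (λ u v → u := v :+ one :* (u :- v :- con (+ 0))) refl (X (F * G)) ((1# - A * var) * (X F * X G)))
    ⟨ (λ n → defect≈0 n F G) ⟩

  geometric : ∀ c (w : Ser) → (∀ n → w (suc n) Base.≈ c Base.* w n) → (1# - cst c * var) * w ≈ cst (w 0)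
  geometric c w hw = trans (solve 3 (λ cc z ww → ((one :- cc :* z) :* ww) := (ww :- cc :* (z :* ww))) refl (cst c) var w) ⟨ pointwise ⟩
    where
    pointwise : w - cst c * (var * w) ≐ cst (w 0)
    pointwise zero = Base.trans (Base.+-congˡ (Base.-‿cong (Base.trans (cst-mul c (var * w) 0) (Base.trans (Base.*-congˡ (var-mul₀ w)) (Base.zeroʳ c)))))
                       (Base.trans (Base.+-congˡ ε⁻¹≈ε) (Base.+-identityʳ _))
    pointwise (suc n) = Base.trans (Base.+-congˡ (Base.-‿cong (Base.trans (cst-mul c (var * w) (suc n)) (Base.*-congˡ (var-mulₛ w n)))))
                          (Base.trans (Base.+-congʳ (hw n)) (Base.-‿inverseʳ _))

  -- 1 - A z is a unit, with inverse Σ aⁿ zⁿ, so it can be cancelled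
  cancel-unit : ∀ {P Q} → (1# - A * var) * P ≈ (1# - A * var) * Q → P ≈ Q
  cancel-unit {P} {Q} e = modulo₂ inverse (Q - P)
    (solve 5 (λ p q g aa z → p := q :+ g :* ((one :- aa :* z) :* p :- (one :- aa :* z) :* q) :+ (q :- p) :* ((one :- aa :* z) :* g :- one)) refl P Q inverse A var)
    e inverse-ok
    where
    inverse : Ser
    inverse = a ^_
    inverse-ok : (1# - A * var) * inverse ≈ 1#
    inverse-ok = trans (geometric a inverse (λ n → Base.refl)) cst-1

  X-var : ∀ F → (1# - A * var) * X (var * F) ≈ var * X F
  X-var F = trans (X-shift (var * F)) (trans (+-cong (trans (cst-cong (var-mul₀ F)) cst-0) (*-congˡ (X-cong ⟨ var-mulₛ F ⟩))) (+-identityˡ _))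

  X-1 : (1# - A * var) * X 1# ≈ 1#
  X-1 = trans (X-shift 1#) (trans (+-cong cst-1 (*-congˡ (trans (X-cong ⟨ (λ n → Base.refl) ⟩) X-0))) (trans (+-congˡ (zeroʳ var)) (+-identityʳ _)))

  -- A recursion P = 1 + z (α P + β P²) determines P coefficient by coefficient.
  module QuadraticUniqueness {P Q α β : Ser}
    (hP : P ≈ 1# + var * (α * P + β * (P * P)))
    (hQ : Q ≈ 1# + var * (α * Q + β * (Q * Q))) where

    constant-term : ∀ {S} (E : Ser) → S ≈ 1# + var * E → S 0 Base.≈ Base.1#
    constant-term E h = Base.trans (at h 0) (Base.trans (Base.+-congˡ (var-mul₀ E)) (Base.+-identityʳ _))

    next-term : ∀ {S} (E : Ser) → S ≈ 1# + var * E → ∀ m → S (suc m) Base.≈ E m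
    next-term E h m = Base.trans (at h (suc m)) (Base.trans (Base.+-identityˡ _) (var-mulₛ E m))

    agree-up-to : ∀ n i → i ≤ n → P i Base.≈ Q i
    agree-up-to n zero _ = Base.trans (constant-term _ hP) (Base.sym (constant-term _ hQ))
    agree-up-to (suc n) (suc m) (s≤s m≤n) = Base.trans (next-term _ hP m) (Base.trans (Base.+-cong
        (*ₛ-local m (λ i _ → Base.refl) ih)
        (*ₛ-local m (λ i _ → Base.refl) (λ j j≤m → *ₛ-local j (λ i i≤j → ih i (ℕP.≤-trans i≤j j≤m)) (λ i i≤j → ih i (ℕP.≤-trans i≤j j≤m)))))
        (Base.sym (next-term _ hQ m)))
      where
      ih : ∀ j → j ≤ m → P j Base.≈ Q j
      ih j j≤m = agree-up-to n j (ℕP.≤-trans j≤m m≤n)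

    unique : P ≈ Q
    unique = ⟨ (λ n → agree-up-to n n ℕP.≤-refl) ⟩

  -- the series y/(1 - y z) = Σ yⁿ⁺¹ zⁿ
  yGeometric : Ser
  yGeometric n = y ^ suc n

  yGeometric-eq : (1# - Y * var) * yGeometric ≈ Y
  yGeometric-eq = trans (geometric y yGeometric (λ n → Base.refl)) (cst-cong (Base.*-identityʳ y))

  -- If t = 1 + z(1+yz)t² and r = (1+y) + z(1-yz)r², then X t = r - y/(1-yz):
  -- both sides satisfy B = 1 + z (A B + (1 - Y z) B²).
  module TransformIdentity (t r : Ser)
    (ht : t ≈ 1# + var * ((1# + Y * var) * (t * t)))
    (hr : r ≈ (1# + Y) + var * ((1# - Y * var) * (r * r))) where

    B : Ser
    B = X t

    B-expand : B ≈ X 1# + X (var * (t * t)) + Y * X (var * (var * (t * t)))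
    B-expand = trans (X-cong (trans ht (solve 3 (λ tt yy z → (one :+ z :* ((one :+ yy :* z) :* tt)) := (one :+ z :* tt :+ yy :* (z :* (z :* tt)))) refl (t * t) Y var)))
      (trans (X-+ _ _) (+-cong (X-+ _ _) (X-cst y _)))

    X-var-square : X (var * (t * t)) ≈ var * (B * B)
    X-var-square = cancel-unit (trans (X-var (t * t)) (trans (*-congˡ (X-multiplicative t t))
      (solve 3 (λ aa z bb → (z :* ((one :- aa :* z) :* bb)) := ((one :- aa :* z) :* (z :* bb))) refl A var (B * B))))

    B-scaled : (1# - A * var) * B ≈ 1# + var * ((1# - Y * var) * (B * B))
    B-scaled = modulo₅ (1# - A * var) 1# Y (1# - A * var + Y * var) (- (var * var * (B * B)))
      (solve 7 (λ b x1 xz xzz aa yy z →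
         ((one :- aa :* z) :* b)
           := (one :+ z :* ((one :- yy :* z) :* (b :* b)))
              :+ (one :- aa :* z) :* (b :- (x1 :+ xz :+ yy :* xzz))
              :+ one :* ((one :- aa :* z) :* x1 :- one)
              :+ yy :* ((one :- aa :* z) :* xzz :- z :* xz)
              :+ (one :- aa :* z :+ yy :* z) :* (xz :- z :* (b :* b))
              :+ (:- (z :* z :* (b :* b))) :* (aa :- (yy :+ yy)))
       refl B (X 1#) (X (var * (t * t))) (X (var * (var * (t * t)))) A Y var)
      B-expand X-1 (X-var (var * (t * t))) X-var-square A≈Y+Y

    B-equation : B ≈ 1# + var * (A * B + (1# - Y * var) * (B * B))
    B-equation = modulo₁ 1#
      (solve 4 (λ b aa yy z → b := (one :+ z :* (aa :* b :+ (one :- yy :* z) :* (b :* b))) :+ one :* ((one :- aa :* z) :* b :- (one :+ z :* ((one :- yy :* z) :* (b :* b))))) refl B A Y var)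
      B-scaled

    Q : Ser
    Q = r - yGeometric

    Q-equation : Q ≈ 1# + var * (A * Q + (1# - Y * var) * (Q * Q))
    Q-equation = modulo₃ 1# (⟦ + 2 ⟧ℤ * var * r - var * yGeometric - 1#) (- (var * (r - yGeometric)))
      (solve 5 (λ rr vv aa yy z →
         (rr :- vv)
           := (one :+ z :* (aa :* (rr :- vv) :+ (one :- yy :* z) :* ((rr :- vv) :* (rr :- vv))))
              :+ one :* (rr :- ((one :+ yy) :+ z :* ((one :- yy :* z) :* (rr :* rr))))
              :+ (con (+ 2) :* z :* rr :- z :* vv :- one) :* ((one :- yy :* z) :* vv :- yy)
              :+ (:- (z :* (rr :- vv))) :* (aa :- (yy :+ yy)))
       refl r yGeometric A Y var)
      hr yGeometric-eq A≈Y+Y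

    X-t≈r-yGeometric : X t ≈ r - yGeometric
    X-t≈r-yGeometric = QuadraticUniqueness.unique B-equation Q-equation

-- The coefficient ring K = ℤ[[x]]; polynomials (coefficient lists) are
-- viewed in K through their coefficient functions, and y = x - 1.
module CoefficientRing where

  open import Defs
  open import Data.Nat using (ℕ; zero; suc)
  open import Data.Integer as ℤ using (+_)
  import Data.Integer.Properties as ℤP
  open import Data.List using (List; []; _∷_; map; foldr)
  open import Relation.Binary.PropositionalEquality as P using (_≡_; refl; cong; cong₂)
  import Algebra

  module K = PowerSeries ℤP.+-*-commutativeRing

  KR : CommutativeRing 0ℓ 0ℓ
  KR = K.seriesRing

  Kt : Set
  Kt = K.Ser

  open import Algebra.Definitions.RawSemiring (Algebra.Semiring.rawSemiring (CommutativeRing.semiring KR)) using (_^_) public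

  ⟦_⟧ : Poly → Kt
  ⟦ p ⟧ = coeff p

  coeff-⊕ : ∀ p q i → coeff (p ⊕ q) i ≡ coeff p i ℤ.+ coeff q i
  coeff-⊕ [] q i = P.sym (ℤP.+-identityˡ _)
  coeff-⊕ (a ∷ p) [] zero = P.sym (ℤP.+-identityʳ _)
  coeff-⊕ (a ∷ p) [] (suc i) = P.sym (ℤP.+-identityʳ _)
  coeff-⊕ (a ∷ p) (b ∷ q) zero = refl
  coeff-⊕ (a ∷ p) (b ∷ q) (suc i) = coeff-⊕ p q i

  coeff-scale : ∀ c p i → coeff (scale c p) i ≡ c ℤ.* coeff p i
  coeff-scale c [] i = P.sym (ℤP.*-zeroʳ c)
  coeff-scale c (a ∷ p) zero = refl
  coeff-scale c (a ∷ p) (suc i) = coeff-scale c p i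

  coeff-⊗ : ∀ p q → ⟦ p ⊗ q ⟧ K.≐ (⟦ p ⟧ K.*ₛ ⟦ q ⟧)
  coeff-⊗ [] q n = P.sym (K.*ₛ-zeroˡ ⟦ q ⟧ n)
  coeff-⊗ (a ∷ p) q zero = P.trans (coeff-⊕ (scale a q) (+ 0 ∷ (p ⊗ q)) 0) (P.trans (cong (ℤ._+ + 0) (coeff-scale a q 0)) (ℤP.+-identityʳ _))
  coeff-⊗ (a ∷ p) q (suc n) = P.trans (coeff-⊕ (scale a q) (+ 0 ∷ (p ⊗ q)) (suc n)) (cong₂ ℤ._+_ (coeff-scale a q (suc n)) (coeff-⊗ p q n))

  yP : Poly
  yP = ℤ.- (+ 1) ∷ + 1 ∷ []

  yK : Kt
  yK = ⟦ yP ⟧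

  module G = PascalTransform KR yK

  coeff-xm1^ : ∀ n → ⟦ xm1^ n ⟧ K.≐ yK ^ n
  coeff-xm1^ zero zero = refl
  coeff-xm1^ zero (suc i) = refl
  coeff-xm1^ (suc n) i = P.trans (coeff-⊗ yP (xm1^ n) i) (K.*ₛ-cong {⟦ yP ⟧} {yK} {⟦ xm1^ n ⟧} (λ _ → refl) (coeff-xm1^ n) i)

  ΣL : {A : Set} → List A → (A → Kt) → Kt
  ΣL [] h = K.0ₛ
  ΣL (a ∷ xs) h = h a K.+ₛ ΣL xs h

  coeff-foldr : {A : Set} (h : A → Poly) (xs : List A) → ⟦ foldr _⊕_ [] (map h xs) ⟧ K.≐ ΣL xs (λ a → ⟦ h a ⟧)
  coeff-foldr h [] i = refl
  coeff-foldr h (a ∷ xs) i = P.trans (coeff-⊕ (h a) (foldr _⊕_ [] (map h xs)) i) (cong (λ w → coeff (h a) i ℤ.+ w) (coeff-foldr h xs i))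

  mono : ℕ → Kt
  mono zero zero = + 1
  mono zero (suc i) = + 0
  mono (suc k) zero = + 0
  mono (suc k) (suc i) = mono k i

module CubeFaces where

  open import Defs
  open import Data.Nat using (suc; _≤_; _<_; z≤n; s≤s)
  import Data.Nat.Properties as ℕP
  open import Data.Bool using (Bool; true; false; _∧_; _∨_; not)
  open import Data.Vec using (Vec; []; _∷_)
  open import Data.List using (List; []; _∷_; foldr)
  open import Data.List.Membership.Propositional using (_∈_)
  open import Data.List.Relation.Unary.Any using (here; there)
  open import Relation.Binary.PropositionalEquality using (_≡_; refl; cong; cong₂; sym; trans)
  open import Data.Empty using (⊥-elim)
  open import Data.Sum using (inj₁; inj₂)

  ∧-trueˡ : ∀ {a b} → a ∧ b ≡ true → a ≡ true
  ∧-trueˡ {true} p = refl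
  ∧-trueʳ : ∀ {a b} → a ∧ b ≡ true → b ≡ true
  ∧-trueʳ {true} p = p
  ∧-true : ∀ {a b} → a ≡ true → b ≡ true → a ∧ b ≡ true
  ∧-true refl refl = refl

  not-true : ∀ {b} → not b ≡ true → b ≡ false
  not-true {false} p = refl

  le3 : F3 → F3 → Bool
  le3 a b = (a ==₃ b) ∨ (b ==₃ ⋆)

  le3-trans : ∀ a b c → le3 a b ≡ true → le3 b c ≡ true → le3 a c ≡ true
  le3-trans z z c p q = q
  le3-trans o o c p q = q
  le3-trans ⋆ ⋆ c p q = q
  le3-trans z ⋆ ⋆ p q = refl
  le3-trans o ⋆ ⋆ p q = refl
  le3-trans z o c () q
  le3-trans o z c () q
  le3-trans ⋆ z c () q
  le3-trans ⋆ o c () q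
  le3-trans z ⋆ z p ()
  le3-trans z ⋆ o p ()
  le3-trans o ⋆ z p ()
  le3-trans o ⋆ o p ()

  le3-antisym : ∀ a b → le3 a b ≡ true → le3 b a ≡ true → a ≡ b
  le3-antisym z z p q = refl
  le3-antisym o o p q = refl
  le3-antisym ⋆ ⋆ p q = refl
  le3-antisym z ⋆ p ()
  le3-antisym o ⋆ p ()
  le3-antisym z o () q
  le3-antisym o z () q
  le3-antisym ⋆ z () q
  le3-antisym ⋆ o () q

  ==₃-sound : ∀ a b → (a ==₃ b) ≡ true → a ≡ b
  ==₃-sound z z p = refl
  ==₃-sound o o p = refl
  ==₃-sound ⋆ ⋆ p = refl
  ==₃-sound z o ()
  ==₃-sound z ⋆ ()
  ==₃-sound o z ()
  ==₃-sound o ⋆ ()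
  ==₃-sound ⋆ z ()
  ==₃-sound ⋆ o ()

  ==₃-refl : ∀ a → (a ==₃ a) ≡ true
  ==₃-refl z = refl
  ==₃-refl o = refl
  ==₃-refl ⋆ = refl

  leV-refl : ∀ {d} (u : Vec F3 d) → leV u u ≡ true
  leV-refl [] = refl
  leV-refl (a ∷ u) = ∧-true (cong (_∨ (a ==₃ ⋆)) (==₃-refl a)) (leV-refl u)

  leV-trans : ∀ {d} (u v w : Vec F3 d) → leV u v ≡ true → leV v w ≡ true → leV u w ≡ true
  leV-trans [] [] [] p q = refl
  leV-trans (a ∷ u) (b ∷ v) (c ∷ w) p q = ∧-true (le3-trans a b c (∧-trueˡ p) (∧-trueˡ q)) (leV-trans u v w (∧-trueʳ p) (∧-trueʳ q))

  leV-antisym : ∀ {d} (u v : Vec F3 d) → leV u v ≡ true → leV v u ≡ true → u ≡ v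
  leV-antisym [] [] p q = refl
  leV-antisym (a ∷ u) (b ∷ v) p q = cong₂ _∷_ (le3-antisym a b (∧-trueˡ p) (∧-trueˡ q)) (leV-antisym u v (∧-trueʳ p) (∧-trueʳ q))

  eqV-sound : ∀ {d} (u v : Vec F3 d) → eqV u v ≡ true → u ≡ v
  eqV-sound [] [] p = refl
  eqV-sound (a ∷ u) (b ∷ v) p = cong₂ _∷_ (==₃-sound a b (∧-trueˡ p)) (eqV-sound u v (∧-trueʳ p))

  eqV-refl : ∀ {d} (u : Vec F3 d) → eqV u u ≡ true
  eqV-refl [] = refl
  eqV-refl (a ∷ u) = ∧-true (==₃-refl a) (eqV-refl u)

  eqV⇒leV : ∀ {d} (u v : Vec F3 d) → eqV u v ≡ true → leV u v ≡ true
  eqV⇒leV u v p with eqV-sound u v p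
  ... | refl = leV-refl u

  leV-allStar : ∀ {d} (u : Vec F3 d) → leV u (allStar d) ≡ true
  leV-allStar [] = refl
  leV-allStar (z ∷ u) = leV-allStar u
  leV-allStar (o ∷ u) = leV-allStar u
  leV-allStar (⋆ ∷ u) = leV-allStar u

  -- strict containment: below v u says that u is a proper face of v
  below : ∀ {d} → Vec F3 d → Vec F3 d → Bool
  below v u = leV u v ∧ not (eqV u v)

  below-trans : ∀ {d} (u w v : Vec F3 d) → below w u ≡ true → below v w ≡ true → below v u ≡ true
  below-trans u w v p q = ∧-true (leV-trans u w v (∧-trueˡ p) (∧-trueˡ q)) (u≠v (eqV u v) refl)
    where
    -- if u = v then u ≤ w ≤ u, so w = v, contradicting w ≠ v
    u≠v : ∀ b → eqV u v ≡ b → not b ≡ true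
    u≠v false e = refl
    u≠v true e with eqV-sound u v e
    ... | refl with leV-antisym w u (∧-trueˡ q) (∧-trueˡ p)
    ... | refl with trans (sym (not-true (∧-trueʳ q))) (eqV-refl w)
    ... | ()

  below-irrefl : ∀ {d} (u : Vec F3 d) → below u u ≡ false
  below-irrefl u rewrite eqV-refl u = ∧-false (leV u u)
    where
    ∧-false : ∀ b → b ∧ false ≡ false
    ∧-false true = refl
    ∧-false false = refl

  stars-mono : ∀ {d} (u v : Vec F3 d) → leV u v ≡ true → stars u ≤ stars v
  stars-mono [] [] p = z≤n
  stars-mono (z ∷ u) (z ∷ v) p = stars-mono u v (∧-trueʳ p)
  stars-mono (z ∷ u) (⋆ ∷ v) p = ℕP.m≤n⇒m≤1+n (stars-mono u v (∧-trueʳ p))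
  stars-mono (o ∷ u) (o ∷ v) p = stars-mono u v (∧-trueʳ p)
  stars-mono (o ∷ u) (⋆ ∷ v) p = ℕP.m≤n⇒m≤1+n (stars-mono u v (∧-trueʳ p))
  stars-mono (⋆ ∷ u) (⋆ ∷ v) p = s≤s (stars-mono u v (∧-trueʳ p))
  stars-mono (z ∷ u) (o ∷ v) ()
  stars-mono (o ∷ u) (z ∷ v) ()
  stars-mono (⋆ ∷ u) (z ∷ v) ()
  stars-mono (⋆ ∷ u) (o ∷ v) ()

  stars-eq : ∀ {d} (u v : Vec F3 d) → leV u v ≡ true → stars u ≡ stars v → u ≡ v
  stars-eq [] [] p e = refl
  stars-eq (z ∷ u) (z ∷ v) p e = cong (z ∷_) (stars-eq u v (∧-trueʳ p) e)
  stars-eq (o ∷ u) (o ∷ v) p e = cong (o ∷_) (stars-eq u v (∧-trueʳ p) e)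
  stars-eq (⋆ ∷ u) (⋆ ∷ v) p e = cong (⋆ ∷_) (stars-eq u v (∧-trueʳ p) (ℕP.suc-injective e))
  stars-eq (z ∷ u) (⋆ ∷ v) p e = ⊥-elim (ℕP.<-irrefl e (s≤s (stars-mono u v (∧-trueʳ p))))
  stars-eq (o ∷ u) (⋆ ∷ v) p e = ⊥-elim (ℕP.<-irrefl e (s≤s (stars-mono u v (∧-trueʳ p))))
  stars-eq (z ∷ u) (o ∷ v) () e
  stars-eq (o ∷ u) (z ∷ v) () e
  stars-eq (⋆ ∷ u) (z ∷ v) () e
  stars-eq (⋆ ∷ u) (o ∷ v) () e

  stars-strict : ∀ {d} (u v : Vec F3 d) → below v u ≡ true → stars u < stars v
  stars-strict u v p with ℕP.m≤n⇒m<n∨m≡n (stars-mono u v (∧-trueˡ p))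
  ... | inj₁ lt = lt
  ... | inj₂ e with stars-eq u v (∧-trueˡ p) e
  ... | refl with trans (sym (not-true (∧-trueʳ p))) (eqV-refl u)
  ... | ()

  extend : ∀ {d} → Vec F3 d → List (Vec F3 (suc d)) → List (Vec F3 (suc d))
  extend v acc = (z ∷ v) ∷ (o ∷ v) ∷ (⋆ ∷ v) ∷ acc

  allVec-complete : ∀ {d} (u : Vec F3 d) → u ∈ allVec d
  allVec-complete [] = here refl
  allVec-complete {suc d} (a ∷ u) = ∈-extend (allVec d) a u (allVec-complete u)
    where
    ∈-extend : ∀ {d} (xs : List (Vec F3 d)) (a : F3) (v : Vec F3 d) → v ∈ xs → (a ∷ v) ∈ foldr extend [] xs
    ∈-extend (x ∷ xs) z v (here refl) = here refl
    ∈-extend (x ∷ xs) o v (here refl) = there (here refl)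
    ∈-extend (x ∷ xs) ⋆ v (here refl) = there (there (here refl))
    ∈-extend (x ∷ xs) a v (there m) = there (there (there (∈-extend xs a v m)))

module FilterLemmas where

  open import Data.Nat using (_≤_; _<_; z≤n; s≤s)
  open import Data.Nat.Properties using (m≤n⇒m≤1+n)
  open import Data.Bool using (Bool; true; false)
  open import Data.List using (List; []; _∷_; map; filterᵇ; length)
  open import Data.List.Membership.Propositional using (_∈_)
  open import Data.List.Relation.Unary.Any using (here; there)
  open import Data.Product using (_×_; _,_)
  open import Relation.Binary.PropositionalEquality using (_≡_; refl; cong)
  open import Function using (_∘_)

  module _ {A : Set} where

    filterᵇ-cong : ∀ {p q : A → Bool} → (∀ x → p x ≡ q x) → ∀ xs → filterᵇ p xs ≡ filterᵇ q xs
    filterᵇ-cong {p} {q} e [] = refl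
    filterᵇ-cong {p} {q} e (x ∷ xs) with p x | q x | e x
    ... | true | .true | refl = cong (x ∷_) (filterᵇ-cong e xs)
    ... | false | .false | refl = filterᵇ-cong e xs

    filterᵇ-none : ∀ {p : A → Bool} → (∀ x → p x ≡ false) → ∀ xs → filterᵇ p xs ≡ []
    filterᵇ-none {p} e [] = refl
    filterᵇ-none {p} e (x ∷ xs) with p x | e x
    ... | false | refl = filterᵇ-none e xs

    filterᵇ-filterᵇ : ∀ {p q : A → Bool} → (∀ x → q x ≡ true → p x ≡ true) → ∀ xs → filterᵇ q (filterᵇ p xs) ≡ filterᵇ q xs
    filterᵇ-filterᵇ {p} {q} h [] = refl
    filterᵇ-filterᵇ {p} {q} h (x ∷ xs) with q x in eq
    ... | false with p x
    ...   | true rewrite eq = filterᵇ-filterᵇ h xs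
    ...   | false = filterᵇ-filterᵇ h xs
    filterᵇ-filterᵇ {p} {q} h (x ∷ xs) | true with p x | h x eq
    ...   | true | refl rewrite eq = cong (x ∷_) (filterᵇ-filterᵇ h xs)

    ∈-filterᵇ⁻ : ∀ {p : A → Bool} {x} xs → x ∈ filterᵇ p xs → p x ≡ true × x ∈ xs
    ∈-filterᵇ⁻ {p} (y ∷ xs) m with p y in eq
    ∈-filterᵇ⁻ {p} (y ∷ xs) (here refl) | true = eq , here refl
    ∈-filterᵇ⁻ {p} (y ∷ xs) (there m) | true with ∈-filterᵇ⁻ xs m
    ... | (a , b) = a , there b
    ∈-filterᵇ⁻ {p} (y ∷ xs) m | false with ∈-filterᵇ⁻ xs m
    ... | (a , b) = a , there b

    length-filterᵇ-≤ : ∀ {p q : A → Bool} → (∀ x → q x ≡ true → p x ≡ true) → ∀ xs → length (filterᵇ q xs) ≤ length (filterᵇ p xs)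
    length-filterᵇ-≤ {p} {q} h [] = z≤n
    length-filterᵇ-≤ {p} {q} h (x ∷ xs) with q x in eq
    ... | true rewrite h x eq = s≤s (length-filterᵇ-≤ h xs)
    ... | false with p x
    ...   | true = m≤n⇒m≤1+n (length-filterᵇ-≤ h xs)
    ...   | false = length-filterᵇ-≤ h xs

    length-filterᵇ-< : ∀ {p q : A → Bool} → (∀ x → q x ≡ true → p x ≡ true) → ∀ {y} xs → y ∈ xs → p y ≡ true → q y ≡ false → length (filterᵇ q xs) < length (filterᵇ p xs)
    length-filterᵇ-< {p} {q} h (x ∷ xs) (here refl) py qy rewrite py | qy = s≤s (length-filterᵇ-≤ h xs)
    length-filterᵇ-< {p} {q} h (x ∷ xs) (there m) py qy with q x in eq
    ... | true rewrite h x eq = s≤s (length-filterᵇ-< h xs m py qy)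
    ... | false with p x
    ...   | true = m≤n⇒m≤1+n (length-filterᵇ-< h xs m py qy)
    ...   | false = length-filterᵇ-< h xs m py qy

  filterᵇ-map : {A B : Set} (p : B → Bool) (f : A → B) (xs : List A) → filterᵇ p (map f xs) ≡ map f (filterᵇ (p ∘ f) xs)
  filterᵇ-map p f [] = refl
  filterᵇ-map p f (x ∷ xs) with p (f x)
  ... | true = cong (f x ∷_) (filterᵇ-map p f xs)
  ... | false = filterᵇ-map p f xs

module ListSums where

  open import Data.Bool using (Bool; true; false; if_then_else_)
  open import Data.List using (List; []; _∷_; map; filterᵇ; _++_)
  open import Data.List.Membership.Propositional using (_∈_)
  open import Data.List.Relation.Unary.Any using (here; there)
  import Relation.Binary.PropositionalEquality as P
  open import Function using (_∘_)
  open import Data.Integer using (+_)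
  open CoefficientRing
  open CommutativeRing KR
  open IntegerSolver KR using (solve; _:=_; _:+_; _:-_; con)
  open ExplicitCongruence KR

  module _ {A : Set} where
    ΣL-cong : ∀ {h h' : A → Kt} (xs : List A) → (∀ x → x ∈ xs → h x ≈ h' x) → ΣL xs h ≈ ΣL xs h'
    ΣL-cong [] e = refl
    ΣL-cong (x ∷ xs) e = +-cong (e x (here P.refl)) (ΣL-cong xs (λ y m → e y (there m)))

    ΣL-filter : ∀ (p : A → Bool) (h : A → Kt) xs → ΣL (filterᵇ p xs) h ≈ ΣL xs (λ x → if p x then h x else 0#)
    ΣL-filter p h [] = refl
    ΣL-filter p h (x ∷ xs) with p x
    ... | true = +ˡ (h x) (ΣL-filter p h xs)
    ... | false = trans (ΣL-filter p h xs) (sym (+-identityˡ (ΣL xs (λ x → if p x then h x else 0#))))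

    ΣL-*ˡ : ∀ c (h : A → Kt) xs → c * ΣL xs h ≈ ΣL xs (λ x → c * h x)
    ΣL-*ˡ c h [] = zeroʳ c
    ΣL-*ˡ c h (x ∷ xs) = trans (distribˡ c (h x) (ΣL xs h)) (+ˡ (c * h x) (ΣL-*ˡ c h xs))

    ΣL-+ : ∀ (h h' : A → Kt) xs → ΣL xs (λ x → h x + h' x) ≈ ΣL xs h + ΣL xs h'
    ΣL-+ h h' [] = sym (+-identityʳ 0#)
    ΣL-+ h h' (x ∷ xs) = trans (+ˡ (h x + h' x) (ΣL-+ h h' xs))
      (solve 4 (λ a b c d → (a :+ b) :+ (c :+ d) := (a :+ c) :+ (b :+ d)) refl (h x) (h' x) (ΣL xs h) (ΣL xs h'))

    ΣL-- : ∀ (h h' : A → Kt) xs → ΣL xs (λ x → h x - h' x) ≈ ΣL xs h - ΣL xs h'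
    ΣL-- h h' [] = solve 0 (con (+ 0) := con (+ 0) :- con (+ 0)) refl
    ΣL-- h h' (x ∷ xs) = trans (+ˡ (h x - h' x) (ΣL-- h h' xs))
      (solve 4 (λ a b c d → (a :- b) :+ (c :- d) := (a :+ c) :- (b :+ d)) refl (h x) (h' x) (ΣL xs h) (ΣL xs h'))

    ΣL-++ : ∀ (w : A → Kt) xs ys → ΣL (xs ++ ys) w ≈ ΣL xs w + ΣL ys w
    ΣL-++ w [] ys = sym (+-identityˡ (ΣL ys w))
    ΣL-++ w (x ∷ xs) ys = trans (+ˡ (w x) (ΣL-++ w xs ys)) (sym (+-assoc (w x) (ΣL xs w) (ΣL ys w)))

  ΣL-map : {A B : Set} (f : A → B) (h : B → Kt) (xs : List A) → ΣL (map f xs) h ≈ ΣL xs (h ∘ f)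
  ΣL-map f h [] = refl
  ΣL-map f h (x ∷ xs) = +ˡ (h (f x)) (ΣL-map f h xs)

module CubeSums where

  open import Defs
  open import Data.Nat as ℕ using (ℕ; zero; suc; _∸_)
  import Data.Nat.Properties as ℕP
  open import Data.Bool using (Bool; if_then_else_)
  open import Data.Vec using (Vec; []; _∷_)
  open import Data.List using ([]; _∷_; foldr)
  import Relation.Binary.PropositionalEquality as P
  open import Function using (_∘_)
  open CoefficientRing
  open CubeFaces
  open ListSums
  open CommutativeRing KR
  open import Relation.Binary.Reasoning.Setoid setoid
  open IntegerSolver KR using (solve; _:=_; _:+_; _:*_)
  open ExplicitCongruence KR

  ΣL-extend : ∀ {d} (h : Vec F3 (suc d) → Kt) xs → ΣL (foldr extend [] xs) h ≈ ΣL xs (λ v → h (z ∷ v) + (h (o ∷ v) + h (⋆ ∷ v)))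
  ΣL-extend h [] = refl
  ΣL-extend h (v ∷ xs) = trans (+ˡ (h (z ∷ v)) (+ˡ (h (o ∷ v)) (+ˡ (h (⋆ ∷ v)) (ΣL-extend h xs))))
    (solve 4 (λ a b c d → a :+ (b :+ (c :+ d)) := (a :+ (b :+ c)) :+ d) refl (h (z ∷ v)) (h (o ∷ v)) (h (⋆ ∷ v)) (ΣL xs (λ v → h (z ∷ v) + (h (o ∷ v) + h (⋆ ∷ v)))))

  -- cubeSum φ n = Σⱼ C(n,j) 2ⁿ⁻ʲ φ(j): a face with n stars has C(n,j) 2ⁿ⁻ʲ
  -- subfaces with j stars (Pascal's rule: fix the first star to z, o or ⋆)
  cubeSum : (ℕ → Kt) → ℕ → Kt
  cubeSum φ zero = φ 0
  cubeSum φ (suc n) = (cubeSum φ n + cubeSum φ n) + cubeSum (φ ∘ suc) n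

  cubeSum-cong : ∀ {φ φ'} n → (∀ j → φ j ≈ φ' j) → cubeSum φ n ≈ cubeSum φ' n
  cubeSum-cong zero e = e 0
  cubeSum-cong (suc n) e = +-cong (+-cong (cubeSum-cong n e) (cubeSum-cong n e)) (cubeSum-cong n (λ j → e (suc j)))

  faceTerm : ∀ {d} → (Vec F3 d → Vec F3 d → Bool) → Vec F3 d → (ℕ → Kt) → Vec F3 d → Kt
  faceTerm rel v φ u = if rel u v then φ (stars u) else 0#

  sum-faces-below : ∀ d (v : Vec F3 d) (φ : ℕ → Kt) → ΣL (allVec d) (faceTerm leV v φ) ≈ cubeSum φ (stars v)
  sum-faces-below zero [] φ = +-identityʳ (φ 0)
  sum-faces-below (suc d) (z ∷ v) φ = trans (ΣL-extend (faceTerm leV (z ∷ v) φ) (allVec d))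
    (trans (ΣL-cong (allVec d) (λ u _ → trans (+ˡ (faceTerm leV v φ u) (+-identityʳ 0#)) (+-identityʳ _))) (sum-faces-below d v φ))
  sum-faces-below (suc d) (o ∷ v) φ = trans (ΣL-extend (faceTerm leV (o ∷ v) φ) (allVec d))
    (trans (ΣL-cong (allVec d) (λ u _ → trans (+-identityˡ (faceTerm leV v φ u + 0#)) (+-identityʳ _))) (sum-faces-below d v φ))
  sum-faces-below (suc d) (⋆ ∷ v) φ = begin
    ΣL (foldr extend [] (allVec d)) (faceTerm leV (⋆ ∷ v) φ) ≈⟨ ΣL-extend _ (allVec d) ⟩
    ΣL (allVec d) (λ u → f u + (f u + g u)) ≈⟨ ΣL-+ f (λ u → f u + g u) (allVec d) ⟩
    ΣL (allVec d) f + ΣL (allVec d) (λ u → f u + g u) ≈⟨ +ˡ (ΣL (allVec d) f) (ΣL-+ f g (allVec d)) ⟩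
    ΣL (allVec d) f + (ΣL (allVec d) f + ΣL (allVec d) g) ≈⟨ sym (+-assoc (ΣL (allVec d) f) (ΣL (allVec d) f) (ΣL (allVec d) g)) ⟩
    ΣL (allVec d) f + ΣL (allVec d) f + ΣL (allVec d) g ≈⟨ +-cong (+-cong (sum-faces-below d v φ) (sum-faces-below d v φ)) (sum-faces-below d v (φ ∘ suc)) ⟩
    cubeSum φ (suc (stars v)) ∎
    where
    f g : Vec F3 d → Kt
    f = faceTerm leV v φ
    g = faceTerm leV v (φ ∘ suc)

  sum-face-equal : ∀ d (v : Vec F3 d) (φ : ℕ → Kt) → ΣL (allVec d) (faceTerm eqV v φ) ≈ φ (stars v)
  sum-face-equal zero [] φ = +-identityʳ (φ 0)
  sum-face-equal (suc d) (z ∷ v) φ = trans (ΣL-extend (faceTerm eqV (z ∷ v) φ) (allVec d))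
    (trans (ΣL-cong (allVec d) (λ u _ → trans (+ˡ (faceTerm eqV v φ u) (+-identityʳ 0#)) (+-identityʳ _))) (sum-face-equal d v φ))
  sum-face-equal (suc d) (o ∷ v) φ = trans (ΣL-extend (faceTerm eqV (o ∷ v) φ) (allVec d))
    (trans (ΣL-cong (allVec d) (λ u _ → trans (+-identityˡ (faceTerm eqV v φ u + 0#)) (+-identityʳ _))) (sum-face-equal d v φ))
  sum-face-equal (suc d) (⋆ ∷ v) φ = trans (ΣL-extend (faceTerm eqV (⋆ ∷ v) φ) (allVec d))
    (trans (ΣL-cong (allVec d) (λ u _ → trans (+-identityˡ (0# + faceTerm eqV v (φ ∘ suc) u)) (+-identityˡ _))) (sum-face-equal d v (φ ∘ suc)))

  cubeSum≈X : ∀ n k (F : ℕ → Kt) → cubeSum (λ j → F j * yK ^ ((n ℕ.+ k) ∸ j)) n ≈ yK ^ k * G.X F n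
  cubeSum≈X zero k F = *-comm _ _
  cubeSum≈X (suc n) k F = begin
    (cubeSum φ n + cubeSum φ n) + cubeSum (φ ∘ suc) n
      ≈⟨ +-cong (+-cong shifted shifted) (cubeSum≈X n k (F ∘ suc)) ⟩
    (yK ^ suc k * G.X F n + yK ^ suc k * G.X F n) + yK ^ k * G.X (F ∘ suc) n
      ≈⟨ solve 4 (λ y p x s → (y :* p :* x :+ y :* p :* x) :+ p :* s := p :* ((y :+ y) :* x :+ s)) refl yK (yK ^ k) (G.X F n) (G.X (F ∘ suc) n) ⟩
    yK ^ k * G.X F (suc n) ∎
    where
    φ : ℕ → Kt
    φ j = F j * yK ^ ((suc n ℕ.+ k) ∸ j)
    shifted : cubeSum φ n ≈ yK ^ suc k * G.X F n
    shifted = trans (cubeSum-cong n (λ j → reflexive (P.cong (λ m → F j * yK ^ (m ∸ j)) (P.sym (ℕP.+-suc n k))))) (cubeSum≈X n (suc k) F)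

module _ where
  open CoefficientRing using (Kt; KR; module G; yK; _^_)
  open CommutativeRing KR using (_≈_; _-_)

  module CubeToric (T R : ℕ → Kt)
    (transform : ∀ s → G.X T s ≈ R s - yK ^ suc s)
    (R-low : ∀ s k → k ≤ ⌊ s /2⌋ → R s k ≡ + 0)
    (T-high : ∀ s k → ⌊ s /2⌋ < k → T s k ≡ + 0) where

    open import Defs
    open import Data.Nat using (ℕ; zero; suc; _∸_; _≤_; _<_; z≤n; s≤s; ⌊_/2⌋)
    import Data.Nat.Properties as ℕP
    open import Data.Integer as ℤ using (ℤ; +_)
    import Data.Integer.Properties as ℤP
    open import Data.Bool using (Bool; true; false; _∧_; not; if_then_else_)
    open import Data.Vec using (Vec; []; _∷_)
    open import Data.List using (List; []; _∷_; map; filterᵇ; length; upTo; applyUpTo)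
    import Data.List.Properties as LP
    open import Data.List.Membership.Propositional using (_∈_)
    open import Data.Maybe using (nothing; just)
    open import Data.Product using (proj₁)
    open import Relation.Nullary using (Dec; yes; no)
    open import Relation.Binary.PropositionalEquality as P using (_≡_)
    open import Function using (_∘_)
    open CoefficientRing
    open CubeFaces
    open FilterLemmas
    open ListSums
    open CubeSums
    open CommutativeRing KR hiding (zero; _≈_; _-_)
    open import Relation.Binary.Reasoning.Setoid setoid
    open IntegerSolver KR using (solve; _:=_; _:+_; _:*_; _:-_)
    open ExplicitCongruence KR
    module ℤSolver = IntegerSolver ℤP.+-*-commutativeRing

    ∸-suc : ∀ s j → j < s → s ∸ j ≡ suc (s ∸ suc j)
    ∸-suc (suc s) zero p = P.refl
    ∸-suc (suc s) (suc j) (s≤s p) = ∸-suc s j p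

    one-⊗ : ∀ p → ⟦ (+ 1 ∷ []) ⊗ p ⟧ K.≐ ⟦ p ⟧
    one-⊗ p i = P.trans (coeff-⊗ (+ 1 ∷ []) p i) (P.trans (K.*ₛ-cong {⟦ + 1 ∷ [] ⟧} {K.1ₛ} {⟦ p ⟧} {⟦ p ⟧} one≐ (λ _ → P.refl) i) (K.*ₛ-identityˡ ⟦ p ⟧ i))
      where
      one≐ : ⟦ + 1 ∷ [] ⟧ K.≐ K.1ₛ
      one≐ zero = P.refl
      one≐ (suc i) = P.refl

    coeff-map-applyUpTo-≤ : ∀ (h : ℕ → ℤ) (f : ℕ → ℕ) m k → k ≤ m → coeff (map h (applyUpTo f (suc m))) k ≡ h (f k)
    coeff-map-applyUpTo-≤ h f m zero p = P.refl
    coeff-map-applyUpTo-≤ h f (suc m) (suc k) (s≤s p) = coeff-map-applyUpTo-≤ h (f ∘ suc) m k p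

    coeff-map-applyUpTo-> : ∀ (h : ℕ → ℤ) (f : ℕ → ℕ) m k → m ≤ k → coeff (map h (applyUpTo f m)) k ≡ + 0
    coeff-map-applyUpTo-> h f zero k p = P.refl
    coeff-map-applyUpTo-> h f (suc m) (suc k) (s≤s p) = coeff-map-applyUpTo-> h (f ∘ suc) m k p

    -- Solving the coefficient equations of y · F = R_s - T_s, using R_s ≡ 0 in
    -- low degrees: F₀ = T₀ and F_{k+1} - F_k = T_{k+1}.
    coefficient₀ : ∀ f r t → ℤ.- (+ 1) ℤ.* f ≡ r ℤ.+ ℤ.- t → r ≡ + 0 → f ≡ t
    coefficient₀ f .(+ 0) t e P.refl =
      P.trans (ℤSolver.solve 1 (λ a → a ℤSolver.:= ℤSolver.:- (ℤSolver.:- ℤSolver.con (+ 1) ℤSolver.:* a)) P.refl f)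
              (P.trans (P.cong ℤ.-_ e) (ℤSolver.solve 1 (λ a → ℤSolver.:- (ℤSolver.con (+ 0) ℤSolver.:+ ℤSolver.:- a) ℤSolver.:= a) P.refl t))

    coefficientₛ : ∀ a b r t → ℤ.- (+ 1) ℤ.* a ℤ.+ b ≡ r ℤ.+ ℤ.- t → r ≡ + 0 → a ℤ.- b ≡ t
    coefficientₛ a b .(+ 0) t e P.refl =
      P.trans (ℤSolver.solve 2 (λ x y → x ℤSolver.:- y ℤSolver.:= ℤSolver.:- (ℤSolver.:- ℤSolver.con (+ 1) ℤSolver.:* x ℤSolver.:+ y)) P.refl a b)
              (P.trans (P.cong ℤ.-_ e) (ℤSolver.solve 1 (λ x → ℤSolver.:- (ℤSolver.con (+ 0) ℤSolver.:+ ℤSolver.:- x) ℤSolver.:= x) P.refl t))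

    module _ (d : ℕ) where
      open Toric (_<F_ {d}) rankF

      difference : Poly → ℕ → ℤ
      difference f zero = coeff f zero
      difference f (suc i) = coeff f (suc i) ℤ.- coeff f i

      gFromF≡ : ∀ r f → gFromF r f ≡ map (difference f) (upTo (suc ⌊ (r ∸ 1) /2⌋))
      gFromF≡ r f = LP.map-cong (λ { zero → P.refl ; (suc i) → P.refl }) (upTo (suc ⌊ (r ∸ 1) /2⌋))

      g-from-f : ∀ s (F : Poly) → yK * ⟦ F ⟧ ≈ R s - T s → ⟦ gFromF (suc s) F ⟧ K.≐ T s
      g-from-f s F E i = P.trans (P.cong (λ L → coeff L i) (gFromF≡ (suc s) F)) (by-degree i (i ℕP.≤? ⌊ s /2⌋))
        where
        -- the shifted part of y·F at degree k+1 is (x · F)ₖ₊₁ = F_k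
        F-shift : ∀ k → coeff F k ≡ (K.sh yK K.*ₛ ⟦ F ⟧) k
        F-shift k = P.sym (P.trans (K.*ₛ-cong {K.sh yK} {K.1ₛ} {⟦ F ⟧} {⟦ F ⟧} x≐1 (λ _ → P.refl) k) (K.*ₛ-identityˡ ⟦ F ⟧ k))
          where
          x≐1 : K.sh yK K.≐ K.1ₛ
          x≐1 zero = P.refl
          x≐1 (suc i) = P.refl
        by-degree : ∀ i → Dec (i ≤ ⌊ s /2⌋) → coeff (map (difference F) (upTo (suc ⌊ s /2⌋))) i ≡ T s i
        by-degree i (no i>) = P.trans (coeff-map-applyUpTo-> (difference F) (λ j → j) (suc ⌊ s /2⌋) i (ℕP.≰⇒> i>)) (P.sym (T-high s i (ℕP.≰⇒> i>)))
        by-degree zero (yes i≤) = P.trans (coeff-map-applyUpTo-≤ (difference F) (λ j → j) ⌊ s /2⌋ 0 i≤)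
          (coefficient₀ (coeff F 0) (R s 0) (T s 0) (K.at E 0) (R-low s 0 z≤n))
        by-degree (suc k) (yes i≤) = P.trans (coeff-map-applyUpTo-≤ (difference F) (λ j → j) ⌊ s /2⌋ (suc k) i≤)
          (coefficientₛ (coeff F (suc k)) (coeff F k) (R s (suc k)) (T s (suc k))
            (P.trans (P.cong (λ w → ℤ.- (+ 1) ℤ.* coeff F (suc k) ℤ.+ w) (F-shift k)) (K.at E (suc k))) (R-low s (suc k) i≤))

      Low : Vec F3 d → List (Face d)
      Low v = nothing ∷ map just (filterᵇ (below v) (allVec d))

      Low-just : ∀ v w → below v w ≡ true → filterᵇ (λ s → s <F just w) (Low v) ≡ Low w
      Low-just v w pw = P.cong (nothing ∷_) (P.trans (filterᵇ-map (λ s → s <F just w) just (filterᵇ (below v) (allVec d)))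
        (P.cong (map just) (filterᵇ-filterᵇ (λ u q → below-trans u w v q pw) (allVec d))))

      Low-nothing : ∀ v → filterᵇ (λ s → s <F nothing) (Low v) ≡ []
      Low-nothing v = filterᵇ-none nothing-minimal (Low v)
        where
        nothing-minimal : ∀ (x : Face d) → (x <F nothing) ≡ false
        nothing-minimal nothing = P.refl
        nothing-minimal (just _) = P.refl

      Low-shrinks : ∀ v w → below v w ≡ true → length (Low w) < length (Low v)
      Low-shrinks v w pw = s≤s (P.subst₂ _<_ (P.sym (LP.length-map just (filterᵇ (below w) (allVec d)))) (P.sym (LP.length-map just (filterᵇ (below v) (allVec d))))
        (length-filterᵇ-< (λ x q → below-trans x w v q pw) (allVec d) (allVec-complete w) pw (below-irrefl w)))

      sum-proper-faces : ∀ v (φ : ℕ → Kt) → ΣL (filterᵇ (below v) (allVec d)) (φ ∘ stars) ≈ cubeSum φ (stars v) - φ (stars v)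
      sum-proper-faces v φ = begin
        ΣL (filterᵇ (below v) (allVec d)) (φ ∘ stars) ≈⟨ ΣL-filter (below v) (φ ∘ stars) (allVec d) ⟩
        ΣL (allVec d) (λ u → if below v u then φ (stars u) else 0#) ≈⟨ ΣL-cong (allVec d) (λ u _ → split (leV u v) (eqV u v) (φ (stars u)) (eqV⇒leV u v)) ⟩
        ΣL (allVec d) (λ u → faceTerm leV v φ u - faceTerm eqV v φ u) ≈⟨ ΣL-- (faceTerm leV v φ) (faceTerm eqV v φ) (allVec d) ⟩
        ΣL (allVec d) (faceTerm leV v φ) - ΣL (allVec d) (faceTerm eqV v φ) ≈⟨ +-cong (sum-faces-below d v φ) (-‿cong (sum-face-equal d v φ)) ⟩
        cubeSum φ (stars v) - φ (stars v) ∎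
        where
        split : ∀ (l e : Bool) (h : Kt) → (e ≡ true → l ≡ true) → (if (l ∧ not e) then h else 0#) ≈ (if l then h else 0#) - (if e then h else 0#)
        split true true h p = sym (-‿inverseʳ h)
        split true false h p = sym (trans (+ˡ h (K.⟨ (λ i → P.refl) ⟩)) (+-identityʳ h))
        split false true h p with p P.refl
        ... | ()
        split false false h p = sym (-‿inverseʳ 0#)

      f-expansion : ∀ n v → (∀ u → below v u ≡ true → ⟦ gF n (Low u) (suc (stars u)) ⟧ K.≐ T (stars u)) →
        ⟦ fF (suc n) (Low v) (suc (stars v)) ⟧ ≈ yK ^ stars v + ΣL (filterᵇ (below v) (allVec d)) (λ u → T (stars u) * yK ^ (stars v ∸ suc (stars u)))
      f-expansion n v ih = begin
        ⟦ fF (suc n) (Low v) (suc s) ⟧ ≈⟨ K.⟨ coeff-foldr term (Low v) ⟩ ⟩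
        ΣL (Low v) (λ t → ⟦ term t ⟧) ≈⟨ +ˡ ⟦ term nothing ⟧ (ΣL-map just (λ t → ⟦ term t ⟧) (filterᵇ (below v) (allVec d))) ⟩
        ⟦ term nothing ⟧ + ΣL (filterᵇ (below v) (allVec d)) (λ u → ⟦ term (just u) ⟧) ≈⟨ +-cong term-empty (ΣL-cong _ term-face) ⟩
        yK ^ s + ΣL (filterᵇ (below v) (allVec d)) (λ u → T (stars u) * yK ^ (s ∸ suc (stars u))) ∎
        where
        s : ℕ
        s = stars v
        term : Face d → Poly
        term t = gF n (filterᵇ (λ s' → s' <F t) (Low v)) (rankF t) ⊗ xm1^ (suc s ∸ 1 ∸ rankF t)
        term-empty : ⟦ term nothing ⟧ ≈ yK ^ s
        term-empty = K.⟨ (λ i → P.trans (P.cong (λ S → coeff (gF n S 0 ⊗ xm1^ s) i) (Low-nothing v)) (P.trans (one-⊗ (xm1^ s) i) (coeff-xm1^ s i))) ⟩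
        term-face : ∀ u → u ∈ filterᵇ (below v) (allVec d) → ⟦ term (just u) ⟧ ≈ T (stars u) * yK ^ (s ∸ suc (stars u))
        term-face u m = K.⟨ (λ i → P.trans (P.cong (λ S → coeff (gF n S (suc (stars u)) ⊗ xm1^ (s ∸ suc (stars u))) i) (Low-just v u pu))
                           (P.trans (coeff-⊗ (gF n (Low u) (suc (stars u))) (xm1^ (s ∸ suc (stars u))) i)
                              (K.*ₛ-cong {⟦ gF n (Low u) (suc (stars u)) ⟧} {T (stars u)} {⟦ xm1^ (s ∸ suc (stars u)) ⟧} {yK ^ (s ∸ suc (stars u))} (ih u pu) (coeff-xm1^ (s ∸ suc (stars u))) i))) ⟩
          where
          pu : below v u ≡ true
          pu = proj₁ (∈-filterᵇ⁻ (allVec d) m)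

      y*f : ∀ n v → (∀ u → below v u ≡ true → ⟦ gF n (Low u) (suc (stars u)) ⟧ K.≐ T (stars u)) →
        yK * ⟦ fF (suc n) (Low v) (suc (stars v)) ⟧ ≈ R (stars v) - T (stars v)
      y*f n v ih = begin
        yK * ⟦ fF (suc n) (Low v) (suc s) ⟧ ≈⟨ *ˡ yK (f-expansion n v ih) ⟩
        yK * (yK ^ s + ΣL xs (λ u → T (stars u) * yK ^ (s ∸ suc (stars u)))) ≈⟨ distribˡ yK (yK ^ s) _ ⟩
        yK ^ suc s + yK * ΣL xs (λ u → T (stars u) * yK ^ (s ∸ suc (stars u))) ≈⟨ +ˡ (yK ^ suc s) (trans (ΣL-*ˡ yK _ xs) (ΣL-cong xs absorb-y)) ⟩
        yK ^ suc s + ΣL xs (φ ∘ stars) ≈⟨ +ˡ (yK ^ suc s) (sum-proper-faces v φ) ⟩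
        yK ^ suc s + (cubeSum φ s - φ s) ≈⟨ +ˡ (yK ^ suc s) (+-cong cubeSum≈XT (-‿cong φs≈Ts)) ⟩
        yK ^ suc s + (G.X T s - T s) ≈⟨ +ˡ (yK ^ suc s) (+ʳ (- T s) (transform s)) ⟩
        yK ^ suc s + ((R s - yK ^ suc s) - T s) ≈⟨ solve 3 (λ p r t → p :+ ((r :- p) :- t) := r :- t) refl (yK ^ suc s) (R s) (T s) ⟩
        R s - T s ∎
        where
        s : ℕ
        s = stars v
        xs : List (Vec F3 d)
        xs = filterᵇ (below v) (allVec d)
        φ : ℕ → Kt
        φ j = T j * yK ^ (s ∸ j)
        absorb-y : ∀ u → u ∈ xs → yK * (T (stars u) * yK ^ (s ∸ suc (stars u))) ≈ φ (stars u)
        absorb-y u m = trans (solve 3 (λ y t p → y :* (t :* p) := t :* (y :* p)) refl yK (T (stars u)) (yK ^ (s ∸ suc (stars u))))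
          (*ˡ (T (stars u)) (reflexive (P.cong (yK ^_) (P.sym (∸-suc s (stars u) (stars-strict u v (proj₁ (∈-filterᵇ⁻ (allVec d) m))))))))
        cubeSum≈XT : cubeSum φ s ≈ G.X T s
        cubeSum≈XT = trans (cubeSum-cong s (λ j → reflexive (P.cong (λ m → T j * yK ^ (m ∸ j)) (P.sym (ℕP.+-identityʳ s)))))
          (trans (cubeSum≈X s 0 T) (*-identityˡ (G.X T s)))
        φs≈Ts : φ s ≈ T s
        φs≈Ts = trans (*ˡ (T s) (reflexive (P.cong (yK ^_) (ℕP.n∸n≡0 s)))) (*-identityʳ (T s))

      g-lower-interval : ∀ n v → length (Low v) ≤ n → ⟦ gF n (Low v) (suc (stars v)) ⟧ K.≐ T (stars v)
      g-lower-interval zero v ()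
      g-lower-interval (suc n) v hl = g-from-f (stars v) (fF (suc n) (Low v) (suc (stars v)))
        (y*f n v (λ u pu → g-lower-interval n u (ℕP.≤-pred (ℕP.≤-trans (Low-shrinks v u pu) hl))))

    stars-allStar : ∀ d → stars (allStar d) ≡ d
    stars-allStar zero = P.refl
    stars-allStar (suc d) = P.cong suc (stars-allStar d)

    L≡Low : ∀ d → L d ≡ Low d (allStar d)
    L≡Low d = P.cong (λ xs → nothing ∷ map just xs) (filterᵇ-cong (λ u → P.cong (λ b → b ∧ not (eqV u (allStar d))) (P.sym (leV-allStar u))) (allVec d))

    gL≐T : ∀ d → ⟦ gL d ⟧ K.≐ T d
    gL≐T d i = P.trans (P.cong (λ w → coeff (Toric.gF (_<F_ {d}) rankF (length (L d)) (L d) (suc w)) i) (P.sym (stars-allStar d)))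
      (P.trans (P.cong (λ S → coeff (Toric.gF (_<F_ {d}) rankF (length S) S (suc (stars (allStar d)))) i) (L≡Low d))
      (P.trans (g-lower-interval d (length (Low d (allStar d))) (allStar d) ℕP.≤-refl i) (P.cong (λ w → T w i) (stars-allStar d))))

-- Plane forests (lists of plane trees) with n vertices, enumerated without
-- repetition: a nonempty forest is a first tree node a followed by the
-- remaining forest b, and sizes a + sizes b = n - 1.
module Forests where

  open import Defs
  open import Data.Nat using (ℕ; zero; suc; _∸_; _≤_; _<_; z≤n; s≤s; _+_)
  import Data.Nat.Properties as ℕP
  open import Data.List using (List; []; _∷_; map; _++_; cartesianProductWith)
  open import Data.List.Membership.Propositional using (_∈_)
  open import Data.List.Membership.Propositional.Properties using (∈-map⁺; ∈-++⁺ˡ; ∈-++⁺ʳ)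
  open import Data.List.Relation.Unary.Any using (here; there)
  open import Data.List.Relation.Unary.All as All using (All; []; _∷_)
  import Data.List.Relation.Unary.All.Properties as AllP
  open import Data.List.Relation.Unary.Unique.Propositional using (Unique)
  import Data.List.Relation.Unary.Unique.Propositional.Properties as UP
  open import Data.List.Relation.Unary.AllPairs using ([]; _∷_)
  open import Data.Product using (_×_; _,_; Σ)
  open import Data.Empty using (⊥)
  open import Relation.Binary.PropositionalEquality as P using (_≡_; refl; cong; cong₂; sym; trans; subst)
  open import Function using (_∘_)
  import Data.Unit

  concatRange : {A : Set} → ℕ → (ℕ → List A) → List A
  concatRange zero φ = []
  concatRange (suc m) φ = φ 0 ++ concatRange m (φ ∘ suc)

  graft : List PlaneTree → List PlaneTree → List PlaneTree
  graft a b = node a ∷ b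

  graftAll : List (List PlaneTree) → List (List PlaneTree) → List (List PlaneTree)
  graftAll xs ys = cartesianProductWith graft xs ys

  forestsFuel : ℕ → ℕ → List (List PlaneTree)
  forestsFuel g zero = [] ∷ []
  forestsFuel zero (suc n) = []
  forestsFuel (suc g) (suc n) = concatRange (suc n) (λ k → graftAll (forestsFuel g k) (forestsFuel g (n ∸ k)))

  forests : ℕ → List (List PlaneTree)
  forests n = forestsFuel n n

  concatRange-cong : {A : Set} → ∀ m {φ ψ : ℕ → List A} → (∀ k → k < m → φ k ≡ ψ k) → concatRange m φ ≡ concatRange m ψ
  concatRange-cong zero e = refl
  concatRange-cong (suc m) e = cong₂ _++_ (e 0 (s≤s z≤n)) (concatRange-cong m (λ k p → e (suc k) (s≤s p)))

  fuel-irrelevant : ∀ g g' n → n ≤ g → n ≤ g' → forestsFuel g n ≡ forestsFuel g' n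
  fuel-irrelevant g g' zero p q = refl
  fuel-irrelevant (suc g) (suc g') (suc n) (s≤s p) (s≤s q) = concatRange-cong (suc n) (λ k k<
    → cong₂ graftAll (fuel-irrelevant g g' k (ℕP.≤-trans (ℕP.≤-pred k<) p) (ℕP.≤-trans (ℕP.≤-pred k<) q))
                 (fuel-irrelevant g g' (n ∸ k) (ℕP.≤-trans (ℕP.m∸n≤m n k) p) (ℕP.≤-trans (ℕP.m∸n≤m n k) q)))

  forestsFuel≡forests : ∀ g n → n ≤ g → forestsFuel g n ≡ forests n
  forestsFuel≡forests g n p = fuel-irrelevant g n n p ℕP.≤-refl

  All-concatRange : {A : Set} {Pr : A → Set} → ∀ m (φ : ℕ → List A) → (∀ k → k < m → All Pr (φ k)) → All Pr (concatRange m φ)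
  All-concatRange zero φ h = []
  All-concatRange (suc m) φ h = AllP.++⁺ (h 0 (s≤s z≤n)) (All-concatRange m (φ ∘ suc) (λ k p → h (suc k) (s≤s p)))

  All-graftAll : ∀ {Pa Pb Pr : List PlaneTree → Set} xs ys → All Pa xs → All Pb ys → (∀ {a b} → Pa a → Pb b → Pr (graft a b)) → All Pr (graftAll xs ys)
  All-graftAll [] ys ha hb f = []
  All-graftAll (x ∷ xs) ys (px ∷ ha) hb f = AllP.++⁺ (AllP.map⁺ (All.map (f px) hb)) (All-graftAll xs ys ha hb f)

  ∈-concatRange : {A : Set} → ∀ m (φ : ℕ → List A) k {x} → k < m → x ∈ φ k → x ∈ concatRange m φ
  ∈-concatRange (suc m) φ zero p mem = ∈-++⁺ˡ mem
  ∈-concatRange (suc m) φ (suc k) (s≤s p) mem = ∈-++⁺ʳ (φ 0) (∈-concatRange m (φ ∘ suc) k p mem)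

  ∈-graftAll : ∀ {a b} xs ys → a ∈ xs → b ∈ ys → graft a b ∈ graftAll xs ys
  ∈-graftAll (x ∷ xs) ys (here refl) mb = ∈-++⁺ˡ (∈-map⁺ (graft x) mb)
  ∈-graftAll (x ∷ xs) ys (there ma) mb = ∈-++⁺ʳ (map (graft x) ys) (∈-graftAll xs ys ma mb)

  forests-sound : ∀ g n → n ≤ g → All (λ f → sizes f ≡ n) (forestsFuel g n)
  forests-sound g zero p = refl ∷ []
  forests-sound (suc g) (suc n) (s≤s p) = All-concatRange (suc n) (λ k → graftAll (forestsFuel g k) (forestsFuel g (n ∸ k))) (λ k k<
    → All-graftAll (forestsFuel g k) (forestsFuel g (n ∸ k)) (forests-sound g k (ℕP.≤-trans (ℕP.≤-pred k<) p)) (forests-sound g (n ∸ k) (ℕP.≤-trans (ℕP.m∸n≤m n k) p))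
        (λ {a} {b} ea eb → cong suc (trans (cong₂ _+_ ea eb) (ℕP.m+[n∸m]≡n (ℕP.≤-pred k<)))))

  forests-complete : ∀ g fs → sizes fs ≤ g → fs ∈ forestsFuel g (sizes fs)
  forests-complete g [] p = here refl
  forests-complete (suc g) (node a ∷ b) (s≤s p) =
    ∈-concatRange (suc (sizes a + sizes b)) (λ k → graftAll (forestsFuel g k) (forestsFuel g ((sizes a + sizes b) ∸ k))) (sizes a) (s≤s (ℕP.m≤m+n (sizes a) (sizes b)))
      (∈-graftAll (forestsFuel g (sizes a)) (forestsFuel g ((sizes a + sizes b) ∸ sizes a))
         (forests-complete g a (ℕP.≤-trans (ℕP.m≤m+n (sizes a) (sizes b)) p))
         (subst (λ m → b ∈ forestsFuel g m) (sym (ℕP.m+n∸m≡n (sizes a) (sizes b))) (forests-complete g b (ℕP.≤-trans (ℕP.m≤n+m (sizes b) (sizes a)) p))))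

  -- distinct split points give disjoint blocks: they differ in the size of the first tree
  firstSize : List PlaneTree → ℕ
  firstSize [] = 0
  firstSize (t ∷ _) = size t

  Unique-concatRange : ∀ m (φ : ℕ → List (List PlaneTree)) (ι : ℕ → ℕ) → (∀ i j → ι i ≡ ι j → i ≡ j)
    → (∀ k → k < m → Unique (φ k)) → (∀ k → k < m → All (λ x → firstSize x ≡ ι k) (φ k)) → Unique (concatRange m φ)
  Unique-concatRange zero φ ι inj blocks-unique first-sizes = []
  Unique-concatRange (suc m) φ ι inj blocks-unique first-sizes = UP.++⁺ (blocks-unique 0 (s≤s z≤n))
    (Unique-concatRange m (φ ∘ suc) (ι ∘ suc) (λ i j e → ℕP.suc-injective (inj (suc i) (suc j) e)) (λ k p → blocks-unique (suc k) (s≤s p)) (λ k p → first-sizes (suc k) (s≤s p)))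
    disjoint
    where
    later-sizes : All (λ x → Σ ℕ (λ j → firstSize x ≡ ι (suc j))) (concatRange m (φ ∘ suc))
    later-sizes = All-concatRange m (φ ∘ suc) (λ k p → All.map (λ {x} e → k , e) (first-sizes (suc k) (s≤s p)))
    disjoint : ∀ {v} → (v ∈ φ 0 × v ∈ concatRange m (φ ∘ suc)) → ⊥
    disjoint (m0 , m1) with All.lookup later-sizes m1
    ... | (j , e) with inj 0 (suc j) (trans (sym (All.lookup (first-sizes 0 (s≤s z≤n)) m0)) e)
    ... | ()

  graft-injective : ∀ {w x y z} → graft w y ≡ graft x z → w ≡ x × y ≡ z
  graft-injective refl = refl , refl

  forests-unique : ∀ g n → n ≤ g → Unique (forestsFuel g n)
  forests-unique g zero p = [] ∷ []
  forests-unique (suc g) (suc n) (s≤s p) = Unique-concatRange (suc n) (λ k → graftAll (forestsFuel g k) (forestsFuel g (n ∸ k))) suc (λ i j → ℕP.suc-injective)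
    (λ k k< → UP.cartesianProductWith⁺ graft graft-injective (forests-unique g k (ℕP.≤-trans (ℕP.≤-pred k<) p)) (forests-unique g (n ∸ k) (ℕP.≤-trans (ℕP.m∸n≤m n k) p)))
    (λ k k< → All-graftAll (forestsFuel g k) (forestsFuel g (n ∸ k)) (forests-sound g k (ℕP.≤-trans (ℕP.≤-pred k<) p)) (All.tabulate {P = λ _ → Data.Unit.⊤} (λ _ → Data.Unit.tt)) (λ ea _ → cong suc ea))



module ForestSeries where

  open import Defs
  open CoefficientRing
  open Forests
  open ListSums using (ΣL-cong; ΣL-*ˡ; ΣL-map; ΣL-++)
  open import Data.Nat using (ℕ; zero; suc; _∸_; _≤_; _<_; z≤n; s≤s)
  import Data.Nat.Properties as ℕP
  open import Data.Integer using (+_)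
  open import Data.Bool using (if_then_else_)
  open import Data.List using (List; []; _∷_; map; _++_)
  open import Data.List.Membership.Propositional using (_∈_)
  open import Data.List.Relation.Unary.Any using (here; there)
  open import Data.List.Relation.Unary.All as All using ()
  open import Relation.Binary.PropositionalEquality as P using (_≡_)
  open import Function using (_∘_)

  open CommutativeRing KR hiding (zero)
  open import Relation.Binary.Reasoning.Setoid setoid
  open ExplicitCongruence KR

  Σrange : ℕ → (ℕ → Kt) → Kt
  Σrange zero φ = 0#
  Σrange (suc m) φ = φ 0 + Σrange m (φ ∘ suc)

  Σrange-cong : ∀ m {φ ψ : ℕ → Kt} → (∀ k → k < m → φ k ≈ ψ k) → Σrange m φ ≈ Σrange m ψ
  Σrange-cong zero e = refl
  Σrange-cong (suc m) {φ} {ψ} e = +-cong (e 0 (s≤s z≤n)) (Σrange-cong m (λ k p → e (suc k) (s≤s p)))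

  module _ {A : Set} where
    ΣL-concatRange : ∀ (w : A → Kt) m φ → ΣL (concatRange m φ) w ≈ Σrange m (λ k → ΣL (φ k) w)
    ΣL-concatRange w zero φ = refl
    ΣL-concatRange w (suc m) φ = trans (ΣL-++ w (φ 0) (concatRange m (φ ∘ suc))) (+ˡ (ΣL (φ 0) w) (ΣL-concatRange w m (φ ∘ suc)))

  ΣL-graftAll : ∀ (w : List PlaneTree → Kt) (α β : List PlaneTree → Kt) xs ys
    → (∀ a → a ∈ xs → ∀ b → w (graft a b) ≈ α a * β b) → ΣL (graftAll xs ys) w ≈ ΣL xs α * ΣL ys β
  ΣL-graftAll w α β [] ys h = sym (zeroˡ (ΣL ys β))
  ΣL-graftAll w α β (x ∷ xs) ys h = begin
    ΣL (map (graft x) ys ++ graftAll xs ys) w ≈⟨ ΣL-++ w (map (graft x) ys) (graftAll xs ys) ⟩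
    ΣL (map (graft x) ys) w + ΣL (graftAll xs ys) w ≈⟨ +-cong (ΣL-map (graft x) w ys) (ΣL-graftAll w α β xs ys (λ a m → h a (there m))) ⟩
    ΣL ys (w ∘ graft x) + ΣL xs α * ΣL ys β ≈⟨ +ʳ (ΣL xs α * ΣL ys β) (ΣL-cong ys (λ b _ → h x (here P.refl) b)) ⟩
    ΣL ys (λ b → α x * β b) + ΣL xs α * ΣL ys β ≈⟨ +ʳ (ΣL xs α * ΣL ys β) (sym (ΣL-*ˡ (α x) β ys)) ⟩
    α x * ΣL ys β + ΣL xs α * ΣL ys β ≈⟨ sym (distribʳ (ΣL ys β) (α x) (ΣL xs α)) ⟩
    (α x + ΣL xs α) * ΣL ys β ∎

  module S = PowerSeries KR
  SR : CommutativeRing 0ℓ 0ℓ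
  SR = S.seriesRing

  *ₛ-as-Σrange : ∀ (F H : ℕ → Kt) n → (F S.*ₛ H) n ≈ Σrange (suc n) (λ k → F k * H (n ∸ k))
  *ₛ-as-Σrange F H zero = sym (+-identityʳ (F 0 * H 0))
  *ₛ-as-Σrange F H (suc n) = +ˡ (F 0 * H (suc n)) (*ₛ-as-Σrange (F ∘ suc) H n)

  -- Weights of forests: a non-root vertex weighs p if it is a leaf that is
  -- the leftmost child of a non-root vertex, and q otherwise.  wNR weighs a
  -- subtree hanging from a non-root position, wS a list of siblings whose
  -- first member may be such a special leaf, wF a forest of root children.
  module W (p q : Kt) where
    mutual
      wNR : PlaneTree → Kt
      wNR (node f) = q * wS f

      wS : List PlaneTree → Kt
      wS [] = 1#
      wS (c ∷ cs) = (if isLeaf c then p else wNR c) * wF cs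

      wF : List PlaneTree → Kt
      wF [] = 1#
      wF (c ∷ cs) = wNR c * wF cs

    -- Φₙ: forests with n vertices; Ψₙ: the same, counted as siblings below a
    -- non-root vertex; Âₙ: trees with n+1 vertices in a non-root position
    Φ Ψ Â : ℕ → Kt
    Φ n = ΣL (forests n) wF
    Ψ n = ΣL (forests n) wS
    Â n = q * Ψ n

    -- the forests whose first tree has k+1 vertices
    block-Φ : ∀ n k → k ≤ n → ΣL (graftAll (forestsFuel n k) (forestsFuel n (n ∸ k))) wF ≈ Â k * Φ (n ∸ k)
    block-Φ n k k≤n = begin
      ΣL (graftAll (forestsFuel n k) (forestsFuel n (n ∸ k))) wF ≈⟨ ΣL-graftAll wF (λ a → q * wS a) wF (forestsFuel n k) (forestsFuel n (n ∸ k)) (λ a _ b → refl) ⟩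
      ΣL (forestsFuel n k) (λ a → q * wS a) * ΣL (forestsFuel n (n ∸ k)) wF
        ≈⟨ reflexive (P.cong₂ (λ X Y → ΣL X (λ a → q * wS a) * ΣL Y wF) (forestsFuel≡forests n k k≤n) (forestsFuel≡forests n (n ∸ k) (ℕP.m∸n≤m n k))) ⟩
      ΣL (forests k) (λ a → q * wS a) * Φ (n ∸ k) ≈⟨ *ʳ (Φ (n ∸ k)) (sym (ΣL-*ˡ q wS (forests k))) ⟩
      Â k * Φ (n ∸ k) ∎

    Φ-shift : ∀ n → Φ (suc n) ≈ (Â S.*ₛ Φ) n
    Φ-shift n = begin
      Φ (suc n) ≈⟨ ΣL-concatRange wF (suc n) (λ k → graftAll (forestsFuel n k) (forestsFuel n (n ∸ k))) ⟩
      Σrange (suc n) (λ k → ΣL (graftAll (forestsFuel n k) (forestsFuel n (n ∸ k))) wF) ≈⟨ Σrange-cong (suc n) (λ k k< → block-Φ n k (ℕP.≤-pred k<)) ⟩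
      Σrange (suc n) (λ k → Â k * Φ (n ∸ k)) ≈⟨ sym (*ₛ-as-Σrange Â Φ n) ⟩
      (Â S.*ₛ Φ) n ∎

    block-Ψ : ∀ n j → j < n → ΣL (graftAll (forestsFuel n (suc j)) (forestsFuel n (n ∸ suc j))) wS ≈ Â (suc j) * Φ (n ∸ suc j)
    block-Ψ n j j<n = begin
      ΣL (graftAll (forestsFuel n (suc j)) (forestsFuel n (n ∸ suc j))) wS ≈⟨ ΣL-graftAll wS (λ a → q * wS a) wF (forestsFuel n (suc j)) (forestsFuel n (n ∸ suc j)) nonleaf-first ⟩
      ΣL (forestsFuel n (suc j)) (λ a → q * wS a) * ΣL (forestsFuel n (n ∸ suc j)) wF
        ≈⟨ reflexive (P.cong₂ (λ X Y → ΣL X (λ a → q * wS a) * ΣL Y wF) (forestsFuel≡forests n (suc j) j<n) (forestsFuel≡forests n (n ∸ suc j) (ℕP.m∸n≤m n (suc j)))) ⟩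
      ΣL (forests (suc j)) (λ a → q * wS a) * Φ (n ∸ suc j) ≈⟨ *ʳ (Φ (n ∸ suc j)) (sym (ΣL-*ˡ q wS (forests (suc j)))) ⟩
      Â (suc j) * Φ (n ∸ suc j) ∎
      where
      nonleaf-first : ∀ a → a ∈ forestsFuel n (suc j) → ∀ b → wS (graft a b) ≈ (q * wS a) * wF b
      nonleaf-first [] m b with All.lookup (forests-sound n (suc j) j<n) m
      ... | ()
      nonleaf-first (c ∷ cs) m b = refl

    -- the same split for Ψ, where a one-vertex first tree weighs p instead of q
    Ψ-shift : ∀ n → Ψ (suc n) ≈ (Â S.*ₛ Φ) n + (p - q) * Φ n
    Ψ-shift n = begin
      Ψ (suc n) ≈⟨ ΣL-concatRange wS (suc n) (λ k → graftAll (forestsFuel n k) (forestsFuel n (n ∸ k))) ⟩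
      ΣL (graftAll ([] ∷ []) (forests n)) wS + Σrange n (λ j → ΣL (graftAll (forestsFuel n (suc j)) (forestsFuel n (n ∸ suc j))) wS)
        ≈⟨ +-cong (ΣL-graftAll wS (λ _ → p) wF ([] ∷ []) (forests n) leaf-first) (Σrange-cong n (λ j j< → block-Ψ n j j<)) ⟩
      (p + 0#) * Φ n + Σrange n (λ j → Â (suc j) * Φ (n ∸ suc j))
        ≈⟨ solve 4 (λ P Q F Rs → (P :+ con (+ 0)) :* F :+ Rs := (Q :* (con (+ 1) :+ con (+ 0)) :* F :+ Rs) :+ (P :- Q) :* F) refl p q (Φ n) (Σrange n (λ j → Â (suc j) * Φ (n ∸ suc j))) ⟩
      (Â 0 * Φ n + Σrange n (λ j → Â (suc j) * Φ (n ∸ suc j))) + (p - q) * Φ n ≈⟨ +ʳ ((p - q) * Φ n) (sym (*ₛ-as-Σrange Â Φ n)) ⟩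
      (Â S.*ₛ Φ) n + (p - q) * Φ n ∎
      where
      open IntegerSolver KR using (solve; _:=_; _:+_; _:*_; _:-_; con)
      leaf-first : ∀ a → a ∈ ([] ∷ []) → ∀ b → wS (graft a b) ≈ p * wF b
      leaf-first .[] (here P.refl) b = refl

    open S using (_≋_; _+ₛ_; _*ₛ_; -ₛ_; 1ₛ; var; cst)

    series-from-shift : ∀ {U E : S.Ser} → U 0 ≈ 1# → (∀ n → U (suc n) ≈ E n) → U ≋ 1ₛ +ₛ var *ₛ E
    series-from-shift {U} {E} h0 hs = S.⟨ pointwise ⟩
      where
      pointwise : ∀ n → U n ≈ (1ₛ +ₛ var *ₛ E) n
      pointwise zero = trans h0 (trans (sym (+-identityʳ 1#)) (+ˡ 1# (sym (S.var-mul₀ E))))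
      pointwise (suc n) = trans (hs n) (trans (sym (S.var-mulₛ E n)) (sym (+-identityˡ ((var *ₛ E) (suc n)))))

    Φ-equation : Φ ≋ 1ₛ +ₛ var *ₛ (Â *ₛ Φ)
    Φ-equation = series-from-shift (+-identityʳ 1#) Φ-shift

    Ψ-equation : Ψ ≋ 1ₛ +ₛ var *ₛ (Â *ₛ Φ +ₛ cst (p - q) *ₛ Φ)
    Ψ-equation = series-from-shift (+-identityʳ 1#) (λ n → trans (Ψ-shift n) (+ˡ ((Â *ₛ Φ) n) (sym (S.cst-mul (p - q) Φ n))))

    Â-equation : Â ≋ cst q *ₛ Ψ
    Â-equation = S.⟨ (λ n → sym (S.cst-mul q Ψ n)) ⟩

    Φ-quadratic : Φ ≋ 1ₛ +ₛ var *ₛ (cst q *ₛ (Φ *ₛ Φ)) +ₛ (var *ₛ var) *ₛ ((cst q *ₛ cst (p - q)) *ₛ (Φ *ₛ Φ))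
    Φ-quadratic = modulo₃ (1ₛ +ₛ -ₛ (var *ₛ cst q *ₛ Φ)) (var *ₛ cst q *ₛ Φ) (var *ₛ Φ)
      (solve 6 (λ F Ps Ah Q D z →
          F := ((one :+ z :* (Q :* (F :* F))) :+ (z :* z) :* ((Q :* D) :* (F :* F)))
            :+ (one :- z :* Q :* F) :* (F :- (one :+ z :* (Ah :* F)))
            :+ (z :* Q :* F) :* (Ps :- (one :+ z :* (Ah :* F :+ D :* F)))
            :+ (z :* F) :* (Ah :- Q :* Ps))
        (CommutativeRing.refl SR) Φ Ψ Â (cst q) (cst (p - q)) var)
      Φ-equation Ψ-equation Â-equation
      where
      open ModuloHypotheses SR
      open IntegerSolver SR using (solve; _:=_; _:+_; _:*_; _:-_; con; Polynomial)
      one : ∀ {m} → Polynomial m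
      one = con (+ 1)

-- The two weightings needed: T_n counts forests with n vertices by special
-- vertices (weight x on special leaves), and R_n = x · (forests counted by
-- their non-special vertices).  Their quadratic equations give the transform
-- identity, and since at most half of the vertices are special, T_n lives in
-- degrees ≤ ⌊n/2⌋ and R_n in degrees > ⌊n/2⌋: the hypotheses of CubeToric.
module SpecialVertexSeries where

  open import Defs
  open CoefficientRing
  open ForestSeries
  open Forests
  open ListSums using (ΣL-cong; ΣL-*ˡ)
  open import Data.Nat as ℕ using (ℕ; zero; suc; _≤_; _<_; z≤n; s≤s; ⌊_/2⌋)
  import Data.Nat.Properties as ℕP
  open import Data.Integer as ℤ using (+_)
  import Data.Integer.Properties as ℤP
  open import Data.Bool using (if_then_else_)
  open import Data.List using (List; []; _∷_; filter; length)
  import Data.List.Properties as LP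
  open import Data.List.Relation.Unary.All as All using (All; []; _∷_)
  open import Relation.Nullary using (yes; no)
  open import Relation.Binary.PropositionalEquality as P using (_≡_; _≢_)
  open import Function using (_∘_)
  open CommutativeRing KR hiding (zero)
  open import Relation.Binary.Reasoning.Setoid setoid
  open ExplicitCongruence KR
  open S using (_≋_; _+ₛ_; _*ₛ_; -ₛ_; 1ₛ; var; cst)

  x : Kt
  x = mono 1

  module Special = W x 1#
  module NonSpecial = W 1# x

  T : ℕ → Kt
  T = Special.Φ

  R : ℕ → Kt
  R = cst x *ₛ NonSpecial.Φ

  x≈1+y : x ≈ 1# + yK
  x≈1+y = K.⟨ pointwise ⟩
    where
    pointwise : ∀ i → x i ≡ (1# + yK) i
    pointwise zero = P.refl
    pointwise (suc zero) = P.refl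
    pointwise (suc (suc i)) = P.refl

  x-1≈y : x - 1# ≈ yK
  x-1≈y = K.⟨ pointwise ⟩
    where
    pointwise : ∀ i → (x - 1#) i ≡ yK i
    pointwise zero = P.refl
    pointwise (suc zero) = P.refl
    pointwise (suc (suc i)) = P.refl

  1-x≈-y : 1# - x ≈ - yK
  1-x≈-y = K.⟨ pointwise ⟩
    where
    pointwise : ∀ i → (1# - x) i ≡ (- yK) i
    pointwise zero = P.refl
    pointwise (suc zero) = P.refl
    pointwise (suc (suc i)) = P.refl

  -- t = 1 + z(1+yz)t²: the quadratic equation of the forests with (p,q) = (x,1)
  T-equation : T ≋ 1ₛ +ₛ var *ₛ ((1ₛ +ₛ G.Y *ₛ var) *ₛ (T *ₛ T))
  T-equation = modulo₃ 1ₛ (var *ₛ T *ₛ T +ₛ var *ₛ var *ₛ T *ₛ T *ₛ cst (x - 1#)) (var *ₛ var *ₛ T *ₛ T)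
    (solve 5 (λ F Q D Y z →
       F := (one :+ z :* ((one :+ Y :* z) :* (F :* F)))
         :+ one :* (F :- ((one :+ z :* (Q :* (F :* F))) :+ (z :* z) :* ((Q :* D) :* (F :* F))))
         :+ (z :* F :* F :+ z :* z :* F :* F :* D) :* (Q :- one)
         :+ (z :* z :* F :* F) :* (D :- Y))
     (CommutativeRing.refl SR) T (cst 1#) (cst (x - 1#)) G.Y var)
    Special.Φ-quadratic G.cst-1 (G.cst-cong x-1≈y)
    where
    open ModuloHypotheses SR
    open IntegerSolver SR using (solve; _:=_; _:+_; _:*_; _:-_; con; Polynomial)
    one : ∀ {m} → Polynomial m
    one = con (+ 1)

  -- r = (1+y) + z(1-yz)r²: from the forests with (p,q) = (1,x)
  R-equation : R ≋ (1ₛ +ₛ G.Y) +ₛ var *ₛ ((1ₛ +ₛ -ₛ (G.Y *ₛ var)) *ₛ (R *ₛ R))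
  R-equation = modulo₃ (cst x) 1ₛ (var *ₛ var *ₛ cst x *ₛ cst x *ₛ NonSpecial.Φ *ₛ NonSpecial.Φ)
    (solve 5 (λ F X D Y z →
       (X :* F) := ((one :+ Y) :+ z :* ((one :- Y :* z) :* ((X :* F) :* (X :* F))))
         :+ X :* (F :- ((one :+ z :* (X :* (F :* F))) :+ (z :* z) :* ((X :* D) :* (F :* F))))
         :+ one :* (X :- (one :+ Y))
         :+ (z :* z :* X :* X :* F :* F) :* (D :- :- Y))
     (CommutativeRing.refl SR) NonSpecial.Φ (cst x) (cst (1# - x)) G.Y var)
    NonSpecial.Φ-quadratic x≈1+Y 1-x≈-Y
    where
    open ModuloHypotheses SR
    open IntegerSolver SR using (solve; _:=_; _:+_; _:*_; _:-_; :-_; con; Polynomial)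
    one : ∀ {m} → Polynomial m
    one = con (+ 1)
    x≈1+Y : cst x ≋ 1ₛ +ₛ G.Y
    x≈1+Y = CommutativeRing.trans SR (G.cst-cong x≈1+y) (CommutativeRing.trans SR (G.cst-+ 1# yK) (CommutativeRing.+-congʳ SR G.cst-1))
    1-x≈-Y : cst (1# - x) ≋ -ₛ G.Y
    1-x≈-Y = CommutativeRing.trans SR (G.cst-cong 1-x≈-y) S.⟨ pointwise ⟩
      where
      pointwise : ∀ n → cst (- yK) n ≈ (-ₛ G.Y) n
      pointwise zero = refl
      pointwise (suc n) = K.⟨ (λ i → P.refl) ⟩

  transform : ∀ s → G.X T s ≈ R s - yK ^ suc s
  transform s = S.at (G.TransformIdentity.X-t≈r-yGeometric T R T-equation R-equation) s

  mono-0 : mono 0 ≈ 1#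
  mono-0 = K.⟨ (λ { zero → P.refl ; (suc i) → P.refl }) ⟩

  mono-+ : ∀ a b → mono (a ℕ.+ b) ≈ mono a * mono b
  mono-+ zero b = trans (sym (*-identityˡ (mono b))) (*ʳ (mono b) (sym mono-0))
  mono-+ (suc a) b = begin
    mono (suc (a ℕ.+ b)) ≈⟨ mono-suc (a ℕ.+ b) ⟩
    K.var * mono (a ℕ.+ b) ≈⟨ *ˡ K.var (mono-+ a b) ⟩
    K.var * (mono a * mono b) ≈⟨ sym (*-assoc K.var (mono a) (mono b)) ⟩
    K.var * mono a * mono b ≈⟨ *ʳ (mono b) (sym (mono-suc a)) ⟩
    mono (suc a) * mono b ∎
    where
    mono-suc : ∀ a → mono (suc a) ≈ K.var * mono a
    mono-suc a = K.⟨ (λ { zero → P.sym (K.var-mul₀ (mono a)) ; (suc i) → P.sym (K.var-mulₛ (mono a) i) }) ⟩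

  mutual
    special-weight-NR : ∀ τ → Special.wNR τ ≈ mono (specNR τ)
    special-weight-NR (node []) = trans (*-identityʳ 1#) (sym mono-0)
    special-weight-NR (node (c ∷ cs)) = trans (*-identityˡ (Special.wS (c ∷ cs))) (special-weight-S c cs)

    special-weight-S : ∀ c cs → Special.wS (c ∷ cs) ≈ mono ((if isLeaf c then 1 else 0) ℕ.+ specNRs (c ∷ cs))
    special-weight-S (node []) cs = trans (*ˡ x (special-weight cs)) (sym (mono-+ 1 (specNRs cs)))
    special-weight-S (node (d ∷ ds)) cs = trans (*-cong (special-weight-NR (node (d ∷ ds))) (special-weight cs)) (sym (mono-+ (specNR (node (d ∷ ds))) (specNRs cs)))

    special-weight : ∀ f → Special.wF f ≈ mono (specNRs f)
    special-weight [] = sym mono-0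
    special-weight (c ∷ cs) = trans (*-cong (special-weight-NR c) (special-weight cs)) (sym (mono-+ (specNR c) (specNRs cs)))

  mutual
    nonSpecial : PlaneTree → ℕ
    nonSpecial (node []) = 1
    nonSpecial (node (c ∷ cs)) = suc ((if isLeaf c then 0 else nonSpecial c) ℕ.+ nonSpecials cs)

    nonSpecials : List PlaneTree → ℕ
    nonSpecials [] = 0
    nonSpecials (c ∷ cs) = nonSpecial c ℕ.+ nonSpecials cs

  mutual
    nonSpecial-weight-NR : ∀ τ → NonSpecial.wNR τ ≈ mono (nonSpecial τ)
    nonSpecial-weight-NR (node []) = *-identityʳ x
    nonSpecial-weight-NR (node (c ∷ cs)) = trans (*ˡ x (nonSpecial-weight-S c cs)) (sym (mono-+ 1 ((if isLeaf c then 0 else nonSpecial c) ℕ.+ nonSpecials cs)))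

    nonSpecial-weight-S : ∀ c cs → NonSpecial.wS (c ∷ cs) ≈ mono ((if isLeaf c then 0 else nonSpecial c) ℕ.+ nonSpecials cs)
    nonSpecial-weight-S (node []) cs = trans (*-identityˡ (NonSpecial.wF cs)) (nonSpecial-weight cs)
    nonSpecial-weight-S (node (d ∷ ds)) cs = trans (*-cong (nonSpecial-weight-NR (node (d ∷ ds))) (nonSpecial-weight cs)) (sym (mono-+ (nonSpecial (node (d ∷ ds))) (nonSpecials cs)))

    nonSpecial-weight : ∀ f → NonSpecial.wF f ≈ mono (nonSpecials f)
    nonSpecial-weight [] = sym mono-0
    nonSpecial-weight (c ∷ cs) = trans (*-cong (nonSpecial-weight-NR c) (nonSpecial-weight cs)) (sym (mono-+ (nonSpecial c) (nonSpecials cs)))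

  double-+ : ∀ a b → (a ℕ.+ b) ℕ.+ (a ℕ.+ b) ≡ (a ℕ.+ a) ℕ.+ (b ℕ.+ b)
  double-+ = solve-∀
    where open import Data.Nat.Tactic.RingSolver using (solve-∀)

  -- each special vertex is a leaf paired injectively with its non-leaf parent,
  -- so at most half of the vertices are special ...
  mutual
    special-bound : ∀ τ → specNR τ ℕ.+ specNR τ ≤ size τ
    special-bound (node []) = z≤n
    special-bound (node (node [] ∷ cs)) = s≤s (P.subst (_≤ suc (sizes cs)) (P.sym (ℕP.+-suc (specNRs cs) (specNRs cs))) (s≤s (specials-bound cs)))
    special-bound (node (node (d ∷ ds) ∷ cs)) = ℕP.m≤n⇒m≤1+n (specials-bound (node (d ∷ ds) ∷ cs))

    specials-bound : ∀ f → specNRs f ℕ.+ specNRs f ≤ sizes f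
    specials-bound [] = z≤n
    specials-bound (c ∷ cs) = P.subst (_≤ size c ℕ.+ sizes cs) (P.sym (double-+ (specNR c) (specNRs cs))) (ℕP.+-mono-≤ (special-bound c) (specials-bound cs))

  mutual
    nonSpecial-bound : ∀ τ → size τ ≤ nonSpecial τ ℕ.+ nonSpecial τ
    nonSpecial-bound (node []) = s≤s z≤n
    nonSpecial-bound (node (node [] ∷ cs)) = s≤s (P.subst (suc (sizes cs) ≤_) (P.sym (ℕP.+-suc (nonSpecials cs) (nonSpecials cs))) (s≤s (nonSpecials-bound cs)))
    nonSpecial-bound (node (node (d ∷ ds) ∷ cs)) = s≤s (ℕP.≤-trans (nonSpecials-bound (node (d ∷ ds) ∷ cs)) (ℕP.+-monoʳ-≤ (nonSpecials (node (d ∷ ds) ∷ cs)) (ℕP.n≤1+n (nonSpecials (node (d ∷ ds) ∷ cs)))))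

    nonSpecials-bound : ∀ f → sizes f ≤ nonSpecials f ℕ.+ nonSpecials f
    nonSpecials-bound [] = z≤n
    nonSpecials-bound (c ∷ cs) = P.subst (size c ℕ.+ sizes cs ≤_) (P.sym (double-+ (nonSpecial c) (nonSpecials cs))) (ℕP.+-mono-≤ (nonSpecial-bound c) (nonSpecials-bound cs))

  half-double : ∀ a → ⌊ a ℕ.+ a /2⌋ ≡ a
  half-double zero = P.refl
  half-double (suc a) = P.trans (P.cong ⌊_/2⌋ (P.cong suc (ℕP.+-suc a a))) (P.cong suc (half-double a))

  half-mono-double : ∀ {a s} → a ℕ.+ a ≤ s → a ≤ ⌊ s /2⌋
  half-mono-double {a} p = P.subst (_≤ _) (half-double a) (ℕP.⌊n/2⌋-mono p)

  half-mono-double' : ∀ {a s} → s ≤ a ℕ.+ a → ⌊ s /2⌋ ≤ a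
  half-mono-double' {a} p = P.subst (_ ≤_) (half-double a) (ℕP.⌊n/2⌋-mono p)

  mono-on : ∀ {m k} → m ≡ k → mono m k ≡ + 1
  mono-on {zero} P.refl = P.refl
  mono-on {suc m} P.refl = mono-on {m} P.refl

  mono-off : ∀ {m k} → m ≢ k → mono m k ≡ + 0
  mono-off {zero} {zero} ne with ne P.refl
  ... | ()
  mono-off {zero} {suc k} ne = P.refl
  mono-off {suc m} {zero} ne = P.refl
  mono-off {suc m} {suc k} ne = mono-off (λ e → ne (P.cong suc e))

  module _ {A : Set} (g : A → ℕ) where
    count-degree : ∀ xs k → ΣL xs (mono ∘ g) k ≡ + length (filter (λ a → g a ℕ.≟ k) xs)
    count-degree [] k = P.refl
    count-degree (a ∷ xs) k with g a ℕ.≟ k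
    ... | yes e = P.trans (P.cong₂ ℤ._+_ (mono-on e) (count-degree xs k))
                          (P.cong (λ l → + length l) (P.sym (LP.filter-accept (λ a → g a ℕ.≟ k) e)))
    ... | no ne = P.trans (P.trans (P.cong₂ ℤ._+_ (mono-off ne) (count-degree xs k)) (ℤP.+-identityˡ _))
                          (P.cong (λ l → + length l) (P.sym (LP.filter-reject (λ a → g a ℕ.≟ k) ne)))

    no-degree : ∀ xs k → All (λ a → g a ≢ k) xs → ΣL xs (mono ∘ g) k ≡ + 0
    no-degree [] k [] = P.refl
    no-degree (a ∷ xs) k (ne ∷ h) = P.trans (P.cong₂ ℤ._+_ (mono-off ne) (no-degree xs k h)) (ℤP.+-identityˡ _)

  T-as-sum : ∀ d → T d ≈ ΣL (forests d) (mono ∘ specNRs)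
  T-as-sum d = ΣL-cong (forests d) (λ f _ → special-weight f)

  T-count : ∀ d k → T d k ≡ + length (filter (λ f → specNRs f ℕ.≟ k) (forests d))
  T-count d k = P.trans (K.at (T-as-sum d) k) (count-degree specNRs (forests d) k)

  T-high : ∀ s k → ⌊ s /2⌋ < k → T s k ≡ + 0
  T-high s k lt = P.trans (K.at (T-as-sum s) k) (no-degree specNRs (forests s) k
    (All.map (λ {f} e eq → ℕP.<-irrefl eq (ℕP.≤-<-trans (half-mono-double (P.subst (specNRs f ℕ.+ specNRs f ≤_) e (specials-bound f))) lt))
             (forests-sound s s ℕP.≤-refl)))

  R-as-sum : ∀ d → R d ≈ ΣL (forests d) (λ f → mono (suc (nonSpecials f)))
  R-as-sum d = begin
    R d ≈⟨ S.cst-mul x NonSpecial.Φ d ⟩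
    x * NonSpecial.Φ d ≈⟨ ΣL-*ˡ x NonSpecial.wF (forests d) ⟩
    ΣL (forests d) (λ f → x * NonSpecial.wF f) ≈⟨ ΣL-cong (forests d) (λ f _ → trans (*ˡ x (nonSpecial-weight f)) (sym (mono-+ 1 (nonSpecials f)))) ⟩
    ΣL (forests d) (λ f → mono (suc (nonSpecials f))) ∎

  R-low : ∀ s k → k ≤ ⌊ s /2⌋ → R s k ≡ + 0
  R-low s k le = P.trans (K.at (R-as-sum s) k) (no-degree (suc ∘ nonSpecials) (forests s) k
    (All.map (λ {f} e eq → ℕP.<-irrefl (P.sym eq) (s≤s (ℕP.≤-trans le (half-mono-double' (P.subst (_≤ nonSpecials f ℕ.+ nonSpecials f) e (nonSpecials-bound f))))))
             (forests-sound s s ℕP.≤-refl)))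

module Enumeration where

  open import Data.Fin using (Fin; zero; suc)
  open import Data.List using (List; _∷_; length; lookup)
  open import Data.List.Membership.Propositional using (_∈_)
  open import Data.List.Membership.Propositional.Properties using (∈-lookup)
  open import Data.List.Membership.Propositional.Properties.WithK using (unique⇒irrelevant)
  open import Data.List.Relation.Unary.Any using (index)
  open import Data.List.Relation.Unary.Any.Properties using (lookup-index)
  open import Data.List.Relation.Unary.Unique.Propositional using (Unique)
  open import Data.Product using (Σ; _,_)
  open import Function.Bundles using (_↔_; mk↔ₛ′)
  open import Relation.Binary.PropositionalEquality using (refl; cong; sym; trans)

  index-∈-lookup : {A : Set} (xs : List A) (i : Fin (length xs)) → index (∈-lookup {xs = xs} i) ≡ i
  index-∈-lookup (x ∷ xs) zero = refl
  index-∈-lookup (x ∷ xs) (suc i) = cong suc (index-∈-lookup xs i)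

  enumeration↔ : {A : Set} {P : A → Set} → (∀ {a} (p q : P a) → p ≡ q) →
                 (xs : List A) → Unique xs → (∀ {a} → a ∈ xs → P a) → (∀ {a} → P a → a ∈ xs) →
                 Fin (length xs) ↔ Σ A P
  enumeration↔ {A} {P} P-irrelevant xs unique sound complete = mk↔ₛ′ to from to-from from-to
    where
    to : Fin (length xs) → Σ A P
    to i = lookup xs i , sound (∈-lookup i)
    from : Σ A P → Fin (length xs)
    from (a , p) = index (complete p)
    Σ-≡ : ∀ {a b} → a ≡ b → (p : P a) (q : P b) → (a , p) ≡ (b , q)
    Σ-≡ refl p q = cong (_ ,_) (P-irrelevant p q)
    to-from : ∀ b → to (from b) ≡ b
    to-from (a , p) = Σ-≡ (sym (lookup-index (complete p))) _ p
    from-to : ∀ i → from (to i) ≡ i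
    from-to i = trans (cong index (unique⇒irrelevant unique _ (∈-lookup i))) (index-∈-lookup xs i)

module PlaneTreeList (d k : ℕ) where

  open import Defs
  open Forests
  open import Data.Nat using (_≟_)
  import Data.Nat.Properties as ℕP
  open import Data.List using (List; filter; map)
  open import Data.List.Membership.Propositional using (_∈_)
  open import Data.List.Membership.Propositional.Properties using (∈-map⁺; ∈-map⁻; ∈-filter⁺; ∈-filter⁻)
  open import Data.List.Relation.Unary.All as All using ()
  open import Data.List.Relation.Unary.Unique.Propositional using (Unique)
  import Data.List.Relation.Unary.Unique.Propositional.Properties as UniqueP
  open import Data.Product using (_×_; _,_)
  open import Relation.Binary.PropositionalEquality using (refl; cong; cong₂; subst)

  HasShape : PlaneTree → Set
  HasShape t = (size t ≡ suc d) × (special t ≡ k)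

  shaped-forests : List (List PlaneTree)
  shaped-forests = filter (λ f → specNRs f ≟ k) (forests d)

  trees : List PlaneTree
  trees = map node shaped-forests

  HasShape-irrelevant : ∀ {t} (p q : HasShape t) → p ≡ q
  HasShape-irrelevant (a , b) (c , e) = cong₂ _,_ (ℕP.≡-irrelevant a c) (ℕP.≡-irrelevant b e)

  trees-unique : Unique trees
  trees-unique = UniqueP.map⁺ node-injective (UniqueP.filter⁺ (λ f → specNRs f ≟ k) (forests-unique d d ℕP.≤-refl))
    where
    node-injective : ∀ {f g} → node f ≡ node g → f ≡ g
    node-injective refl = refl

  trees-sound : ∀ {t} → t ∈ trees → HasShape t
  trees-sound t∈ with ∈-map⁻ node t∈
  ... | f , f∈ , refl with ∈-filter⁻ (λ f → specNRs f ≟ k) f∈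
  ... | f∈forests , spec≡k = cong suc (All.lookup (forests-sound d d ℕP.≤-refl) f∈forests) , spec≡k

  trees-complete : ∀ {t} → HasShape t → t ∈ trees
  trees-complete {node f} (size≡ , spec≡k) =
    ∈-map⁺ node (∈-filter⁺ (λ f → specNRs f ≟ k) (subst (λ n → f ∈ forestsFuel d n) sizes≡d (forests-complete d f (ℕP.≤-reflexive sizes≡d))) spec≡k)
    where
    sizes≡d : sizes f ≡ d
    sizes≡d = ℕP.suc-injective size≡

open import Defs
open import Data.Fin using (Fin)
open import Data.Product using (Σ; ∃-syntax; _×_; _,_)
open import Function.Bundles using (_↔_)
open import Data.List using (length)
open import Data.List.Properties using (length-map)
open import Relation.Binary.PropositionalEquality using (cong; trans; sym)
open CubeToric SpecialVertexSeries.T SpecialVertexSeries.R SpecialVertexSeries.transform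
               SpecialVertexSeries.R-low SpecialVertexSeries.T-high using (gL≐T)

lemma3p3 : (d k : ℕ) →
    ∃[ m ] ((coeff (gL d) k ≡ + m) ×
            (Fin m ↔ Σ PlaneTree (λ t → (size t ≡ suc d) × (special t ≡ k))))
lemma3p3 d k = length trees , coefficient≡count , bijection
  where
  open PlaneTreeList d k
  coefficient≡count : coeff (gL d) k ≡ + length trees
  coefficient≡count = trans (gL≐T d k) (trans (SpecialVertexSeries.T-count d k) (cong +_ (sym (length-map node shaped-forests))))
  bijection : Fin (length trees) ↔ Σ PlaneTree HasShape
  bijection = Enumeration.enumeration↔ HasShape-irrelevant trees trees-unique trees-sound trees-complete
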